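{- Let $n\geq 10$. Then $\gamma^{LD}(\mathbb{F}^n)\geq \frac{2^{n+1}}{n+2}$.
   Context: $\mathbb{F}^n$ is the binary Hamming space (binary words of length $n$, adjacent when they differ in exactly one coordinate). For a code $C\subseteq\mathbb{F}^n$ (nonempty set) and a word $\mathbf{u}$, $I(\mathbf{u})=C\cap N[\mathbf{u}]$, where $N[\mathbf{u}]$ is $\mathbf{u}$ together with all words at Hamming distance $1$ from $\mathbf{u}$. $C$ is locating-dominating if $I(\mathbf{u})\neq\emptyset$ for all words $\mathbf{u}$ and $I(\mathbf{u})\neq I(\mathbf{v})$ for all distinct words $\mathbf{u},\mathbf{v}\notin C$. $\gamma^{LD}(\mathbb{F}^n)$ denotes the minimum cardinality of a locating-dominating code in $\mathbb{F}^n$. -}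

module Defs where

open import Data.Bool using (Bool; true; false; _≟_)
open import Data.Nat using (ℕ; zero; suc; _+_; _≤_)
open import Data.Vec using (Vec; []; _∷_)
open import Data.List using (List; []; _∷_; map; _++_; filter)
import Data.List as L
open import Data.Product using (∃; _×_)
open import Relation.Binary.PropositionalEquality using (_≡_; _≢_)
open import Relation.Nullary using (¬_)
open import Function.Bundles using (_⇔_)

-- Binary words of length n (points of the Hamming space F^n)
Word : ℕ → Set
Word n = Vec Bool n

dist : ∀ {n} → Word n → Word n → ℕ
dist [] [] = 0
dist (x ∷ xs) (y ∷ ys) with x ≟ y
... | Relation.Nullary.yes _ = dist xs ys
... | Relation.Nullary.no  _ = suc (dist xs ys)

allWords : ∀ n → List (Word n)
allWords zero = [] ∷ []
allWords (suc n) = map (false ∷_) (allWords n) ++ map (true ∷_) (allWords n)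

Code : ℕ → Set
Code n = Word n → Bool

size : ∀ {n} → Code n → ℕ
size {n} C = L.length (filter (λ w → C w ≟ true) (allWords n))

InI : ∀ {n} → Code n → Word n → Word n → Set
InI C u w = (C w ≡ true) × (dist u w ≤ 1)

IsLocatingDominating : ∀ {n} → Code n → Set
IsLocatingDominating {n} C =
  (∀ (u : Word n) → ∃ λ w → InI C u w)
  × (∀ (u v : Word n) → C u ≡ false → C v ≡ false → u ≢ v →
       ¬ (∀ (w : Word n) → InI C u w ⇔ InI C v w))

-- Discharging.  Every codeword starts with charge 6 (n + 2); charge then moves along edges so
-- that every word ends with at least 12, whence 12 · 2ⁿ ≤ 6 (n + 2) |C|.  A codeword sends 6 to
-- each non-codeword neighbour, and 6 more to a neighbour it dominates alone (a lone neighbour;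
-- by the locating property a codeword has at most one).  A non-codeword of codeword degree t then
-- has 6t (plus 6 if t = 1) and pays share t to each needy codeword, i.e. an isolated codeword
-- with a lone neighbour; this keeps 12 as long as t · share t ≤ 6t − 12 (+ 6).  A needy codeword
-- offered less than 6 in total is starved, and the locating property forces its neighbourhood
-- to be rigid: one lone neighbour, one hub of degree n − 1 and all others of degree 2.  The hub
-- pays the starved codeword 6 instead, and its resulting deficit is paid by its first generous
-- neighbour (a codeword with a codeword neighbour and no lone neighbour).  A generous codeword
-- is adjacent to at most two hubs in deficit and pays at most 6 in total.

module Submission where

open import Defs
open import Data.Nat using (ℕ; zero; suc; _+_; _*_; _^_; _∸_; _≤_; _<_; z≤n; s≤s; s≤s⁻¹; _≤?_; _≡ᵇ_)
open import Data.Nat.Properties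
open import Data.Nat.Tactic.RingSolver using (solve-∀)
open import Data.Bool as B using (Bool; true; false; not; _∧_; if_then_else_)
open import Data.Bool.Properties using (not-¬; ¬-not; T-≡)
open import Data.Fin as F using (Fin; zero; suc)
open import Data.Fin.Properties using (any?)
import Data.Fin.Properties as Fin
open import Data.Vec using ([]; _∷_)
open import Data.Vec.Properties using (∷-injectiveˡ; ∷-injectiveʳ)
open import Data.List as L using (List; []; _∷_)
open import Data.Product using (∃; _×_; _,_; proj₁; proj₂)
open import Data.Sum using (_⊎_; inj₁; inj₂)
open import Data.Empty using (⊥; ⊥-elim)
open import Relation.Nullary using (¬_; Dec; yes; no; ¬?; _×-dec_)
open import Relation.Nullary.Decidable using (True; toWitness)
open import Relation.Binary.PropositionalEquality
open import Function using (_∘_)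
open import Function.Bundles using (mk⇔; Equivalence)

flip : ∀ {n} → Fin n → Word n → Word n
flip zero    (b ∷ v) = not b ∷ v
flip (suc i) (b ∷ v) = b ∷ flip i v

flip-involutive : ∀ {n} (i : Fin n) u → flip i (flip i u) ≡ u
flip-involutive zero    (true  ∷ v) = refl
flip-involutive zero    (false ∷ v) = refl
flip-involutive (suc i) (b ∷ v)     = cong (b ∷_) (flip-involutive i v)

flip-comm : ∀ {n} (i j : Fin n) u → flip i (flip j u) ≡ flip j (flip i u)
flip-comm zero    zero    u       = refl
flip-comm zero    (suc j) (b ∷ v) = refl
flip-comm (suc i) zero    (b ∷ v) = refl
flip-comm (suc i) (suc j) (b ∷ v) = cong (b ∷_) (flip-comm i j v)

flip-injectiveˡ : ∀ {n} (i j : Fin n) u → flip i u ≡ flip j u → i ≡ j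
flip-injectiveˡ zero    zero    u       e = refl
flip-injectiveˡ zero    (suc j) (b ∷ v) e = ⊥-elim (not-¬ refl (sym (∷-injectiveˡ e)))
flip-injectiveˡ (suc i) zero    (b ∷ v) e = ⊥-elim (not-¬ refl (∷-injectiveˡ e))
flip-injectiveˡ (suc i) (suc j) (b ∷ v) e =
  cong suc (flip-injectiveˡ i j v (∷-injectiveʳ e))

dist-refl : ∀ {n} (u : Word n) → dist u u ≡ 0
dist-refl []          = refl
dist-refl (true ∷ v)  = dist-refl v
dist-refl (false ∷ v) = dist-refl v

dist-flip : ∀ {n} (i : Fin n) u → dist u (flip i u) ≡ 1
dist-flip zero    (true ∷ v)  = cong suc (dist-refl v)
dist-flip zero    (false ∷ v) = cong suc (dist-refl v)
dist-flip (suc i) (true ∷ v)  = dist-flip i v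
dist-flip (suc i) (false ∷ v) = dist-flip i v

dist-flip≤1 : ∀ {n} (i : Fin n) u → dist u (flip i u) ≤ 1
dist-flip≤1 i u = ≤-reflexive (dist-flip i u)

dist≡0⇒≡ : ∀ {n} (u w : Word n) → dist u w ≡ 0 → w ≡ u
dist≡0⇒≡ []       []       e = refl
dist≡0⇒≡ (x ∷ xs) (y ∷ ys) e with x B.≟ y
... | yes refl = cong (x ∷_) (dist≡0⇒≡ xs ys e)

dist≤1⇒≡⊎flip : ∀ {n} (u w : Word n) → dist u w ≤ 1 → w ≡ u ⊎ ∃ λ i → w ≡ flip i u
dist≤1⇒≡⊎flip []       []       _ = inj₁ refl
dist≤1⇒≡⊎flip (x ∷ xs) (y ∷ ys) d with x B.≟ y
dist≤1⇒≡⊎flip (x ∷ xs) (y ∷ ys) d | yes refl with dist≤1⇒≡⊎flip xs ys d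
... | inj₁ e       = inj₁ (cong (x ∷_) e)
... | inj₂ (i , e) = inj₂ (suc i , cong (x ∷_) e)
dist≤1⇒≡⊎flip (x ∷ xs) (y ∷ ys) (s≤s d) | no x≢y =
  inj₂ (zero , cong₂ _∷_ (¬-not (x≢y ∘ sym)) (dist≡0⇒≡ xs ys (n≤0⇒n≡0 d)))

-- Finite sums

∑ : ∀ {n} → (Fin n → ℕ) → ℕ
∑ {zero}  f = 0
∑ {suc n} f = f zero + ∑ (f ∘ suc)

∑-cong : ∀ {n} {f g : Fin n → ℕ} → (∀ i → f i ≡ g i) → ∑ f ≡ ∑ g
∑-cong {zero}  h = refl
∑-cong {suc n} h = cong₂ _+_ (h zero) (∑-cong (h ∘ suc))

∑-mono : ∀ {n} {f g : Fin n → ℕ} → (∀ i → f i ≤ g i) → ∑ f ≤ ∑ g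
∑-mono {zero}  h = z≤n
∑-mono {suc n} h = +-mono-≤ (h zero) (∑-mono (h ∘ suc))

∑-const : ∀ {n} k → ∑ {n} (λ _ → k) ≡ n * k
∑-const {zero}  k = refl
∑-const {suc n} k = cong (k +_) (∑-const {n} k)

∑-zero : ∀ {n} (f : Fin n → ℕ) → (∀ i → f i ≡ 0) → ∑ f ≡ 0
∑-zero {n} f h = trans (∑-cong h) (trans (∑-const {n} 0) (*-zeroʳ n))

∑-distrib-+ : ∀ {n} (f g : Fin n → ℕ) → ∑ (λ i → f i + g i) ≡ ∑ f + ∑ g
∑-distrib-+ {zero}  f g = refl
∑-distrib-+ {suc n} f g =
  trans (cong (f zero + g zero +_) (∑-distrib-+ (f ∘ suc) (g ∘ suc)))
        (interchange (f zero) (g zero) (∑ (f ∘ suc)) (∑ (g ∘ suc)))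
  where
  interchange : ∀ a b c d → a + b + (c + d) ≡ a + c + (b + d)
  interchange = solve-∀

∑-*ˡ : ∀ {n} k (f : Fin n → ℕ) → ∑ (λ i → k * f i) ≡ k * ∑ f
∑-*ˡ {zero}  k f = sym (*-zeroʳ k)
∑-*ˡ {suc n} k f =
  trans (cong (k * f zero +_) (∑-*ˡ k (f ∘ suc))) (sym (*-distribˡ-+ k (f zero) _))

∑-positive : ∀ {n} (f : Fin n → ℕ) → 0 < ∑ f → ∃ λ i → 0 < f i
∑-positive {suc n} f p with f zero in eq
... | suc _ = zero , subst (0 <_) (sym eq) (s≤s z≤n)
... | zero with ∑-positive (f ∘ suc) p
...   | i , q = suc i , q

_∖_ : ∀ {n} → (Fin n → ℕ) → Fin n → Fin n → ℕ
(f ∖ i) k with k F.≟ i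
... | yes _ = 0
... | no  _ = f k

∖-self : ∀ {n} (f : Fin n → ℕ) i → (f ∖ i) i ≡ 0
∖-self f i with i F.≟ i
... | yes _  = refl
... | no i≢i = ⊥-elim (i≢i refl)

∖-other : ∀ {n} (f : Fin n → ℕ) {i k} → k ≢ i → (f ∖ i) k ≡ f k
∖-other f {i} {k} k≢i with k F.≟ i
... | yes k≡i = ⊥-elim (k≢i k≡i)
... | no  _   = refl

∖-mono : ∀ {n} {f g : Fin n → ℕ} i → (∀ k → f k ≤ g k) → ∀ k → (f ∖ i) k ≤ (g ∖ i) k
∖-mono i f≤g k with k F.≟ i
... | yes _ = z≤n
... | no  _ = f≤g k

∖-positive : ∀ {n} (f : Fin n → ℕ) i k → 0 < (f ∖ i) k → k ≢ i × 0 < f k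
∖-positive f i k p with k F.≟ i
... | no k≢i = k≢i , p

∑-∖ : ∀ {n} (f : Fin n → ℕ) i → ∑ f ≡ f i + ∑ (f ∖ i)
∑-∖ f zero    = refl
∑-∖ f (suc i) = begin
  f zero + ∑ (f ∘ suc)                               ≡⟨ cong (f zero +_) (∑-∖ (f ∘ suc) i) ⟩
  f zero + (f (suc i) + ∑ ((f ∘ suc) ∖ i))             ≡⟨ x+[y+z]≡y+[x+z] (f zero) (f (suc i)) _ ⟩
  f (suc i) + (f zero + ∑ ((f ∘ suc) ∖ i))             ≡⟨ cong (f (suc i) +_) (cong₂ _+_
                                                          (sym (∖-other f {suc i} λ ())) (∑-cong tail)) ⟩
  f (suc i) + ((f ∖ suc i) zero + ∑ ((f ∖ suc i) ∘ suc)) ∎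
  where
  open ≡-Reasoning
  x+[y+z]≡y+[x+z] : ∀ x y z → x + (y + z) ≡ y + (x + z)
  x+[y+z]≡y+[x+z] = solve-∀
  tail′ : ∀ k → Dec (k ≡ i) → ((f ∘ suc) ∖ i) k ≡ (f ∖ suc i) (suc k)
  tail′ k (yes refl) = trans (∖-self (f ∘ suc) k) (sym (∖-self f (suc k)))
  tail′ k (no k≢i)   = trans (∖-other (f ∘ suc) k≢i) (sym (∖-other f (k≢i ∘ Fin.suc-injective)))
  tail : ∀ k → ((f ∘ suc) ∖ i) k ≡ (f ∖ suc i) (suc k)
  tail k = tail′ k (k F.≟ i)

∑-∖∖ : ∀ {n} (f : Fin n → ℕ) p q → q ≢ p → ∑ f ≡ f p + f q + ∑ ((f ∖ p) ∖ q)
∑-∖∖ f p q q≢p = begin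
  ∑ f                                   ≡⟨ ∑-∖ f p ⟩
  f p + ∑ (f ∖ p)                       ≡⟨ cong (f p +_) (∑-∖ (f ∖ p) q) ⟩
  f p + ((f ∖ p) q + ∑ ((f ∖ p) ∖ q))   ≡⟨ cong (λ x → f p + (x + ∑ ((f ∖ p) ∖ q))) (∖-other f q≢p) ⟩
  f p + (f q + ∑ ((f ∖ p) ∖ q))         ≡⟨ sym (+-assoc (f p) _ _) ⟩
  f p + f q + ∑ ((f ∖ p) ∖ q)           ∎
  where open ≡-Reasoning

≤∑ : ∀ {n} (f : Fin n → ℕ) i → f i ≤ ∑ f
≤∑ f i = ≤-trans (m≤m+n (f i) _) (≤-reflexive (sym (∑-∖ f i)))

pair≤∑ : ∀ {n} (f : Fin n → ℕ) i k → i ≢ k → f i + f k ≤ ∑ f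
pair≤∑ f i k i≢k = begin
  f i + f k         ≡⟨ cong (f i +_) (sym (∖-other f (i≢k ∘ sym))) ⟩
  f i + (f ∖ i) k   ≤⟨ +-monoʳ-≤ (f i) (≤∑ (f ∖ i) k) ⟩
  f i + ∑ (f ∖ i)   ≡⟨ sym (∑-∖ f i) ⟩
  ∑ f               ∎
  where open ≤-Reasoning

triple≤∑ : ∀ {n} (f : Fin n → ℕ) i k l → i ≢ k → i ≢ l → k ≢ l → f i + f k + f l ≤ ∑ f
triple≤∑ f i k l i≢k i≢l k≢l = begin
  f i + f k + f l                 ≡⟨ +-assoc (f i) _ _ ⟩
  f i + (f k + f l)               ≡⟨ cong₂ (λ x y → f i + (x + y))
                                       (sym (∖-other f (i≢k ∘ sym))) (sym (∖-other f (i≢l ∘ sym))) ⟩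
  f i + ((f ∖ i) k + (f ∖ i) l)   ≤⟨ +-monoʳ-≤ (f i) (pair≤∑ (f ∖ i) k l k≢l) ⟩
  f i + ∑ (f ∖ i)                 ≡⟨ sym (∑-∖ f i) ⟩
  ∑ f                             ∎
  where open ≤-Reasoning

∑-ones : ∀ {n} → ∑ {n} (λ _ → 1) ≡ n
∑-ones {n} = trans (∑-const {n} 1) (*-identityʳ n)

Binary : ∀ {n} → (Fin n → ℕ) → Set
Binary f = ∀ i → f i ≤ 1

positive-avoiding : ∀ {n} (f : Fin n → ℕ) p → f p ≤ 1 → 2 ≤ ∑ f → ∃ λ k → k ≢ p × 0 < f k
positive-avoiding f p fp≤1 2≤∑ with ∑-positive (f ∖ p) (+-cancelˡ-≤ 1 1 _ (begin
    2                   ≤⟨ 2≤∑ ⟩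
    ∑ f                 ≡⟨ ∑-∖ f p ⟩
    f p + ∑ (f ∖ p)     ≤⟨ +-monoˡ-≤ _ fp≤1 ⟩
    1 + ∑ (f ∖ p)       ∎))
  where open ≤-Reasoning
... | k , pk = k , ∖-positive f p k pk

positive-avoiding₂ : ∀ {n} (f : Fin n → ℕ) → Binary f → ∀ p q → q ≢ p → 3 ≤ ∑ f →
                     ∃ λ k → k ≢ p × k ≢ q × 0 < f k
positive-avoiding₂ f bin p q q≢p 3≤∑ with ∑-positive ((f ∖ p) ∖ q) (+-cancelˡ-≤ 2 1 _ (begin
    3                            ≤⟨ 3≤∑ ⟩
    ∑ f                          ≡⟨ ∑-∖∖ f p q q≢p ⟩
    f p + f q + ∑ ((f ∖ p) ∖ q)  ≤⟨ +-monoˡ-≤ _ (+-mono-≤ (bin p) (bin q)) ⟩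
    2 + ∑ ((f ∖ p) ∖ q)          ∎))
  where open ≤-Reasoning
... | k , pk with ∖-positive (f ∖ p) q k pk
...   | k≢q , pk′ with ∖-positive f p k pk′
...     | k≢p , fk = k , k≢p , k≢q , fk

two-positive : ∀ {n} (f : Fin n → ℕ) → Binary f → 2 ≤ ∑ f → ∃ λ i → ∃ λ k → i ≢ k × 0 < f i × 0 < f k
two-positive f bin 2≤∑ with ∑-positive f (≤-trans (s≤s z≤n) 2≤∑)
... | i , fi with positive-avoiding f i (bin i) 2≤∑
...   | k , k≢i , fk = i , k , k≢i ∘ sym , fi , fk

∑+1≤n : ∀ {n} (f : Fin n → ℕ) → Binary f → ∀ a → f a ≡ 0 → ∑ f + 1 ≤ n
∑+1≤n {n} f bin a fa≡0 = begin
  ∑ f + 1                      ≡⟨ cong (_+ 1) (trans (∑-∖ f a) (cong (_+ ∑ (f ∖ a)) fa≡0)) ⟩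
  ∑ (f ∖ a) + 1                ≤⟨ +-monoˡ-≤ 1 (∑-mono (∖-mono a bin)) ⟩
  ∑ ((λ _ → 1) ∖ a) + 1        ≡⟨ +-comm _ 1 ⟩
  1 + ∑ ((λ _ → 1) ∖ a)        ≡⟨ sym (∑-∖ (λ _ → 1) a) ⟩
  ∑ {n} (λ _ → 1)              ≡⟨ ∑-ones ⟩
  n                            ∎
  where open ≤-Reasoning

∑+2≤n : ∀ {n} (f : Fin n → ℕ) → Binary f → ∀ p q → q ≢ p → f p ≡ 0 → f q ≡ 0 → ∑ f + 2 ≤ n
∑+2≤n {n} f bin p q q≢p fp≡0 fq≡0 = begin
  ∑ f + 2                           ≡⟨ cong (_+ 2) (trans (∑-∖∖ f p q q≢p)
                                         (cong₂ (λ x y → x + y + ∑ ((f ∖ p) ∖ q)) fp≡0 fq≡0)) ⟩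
  ∑ ((f ∖ p) ∖ q) + 2               ≤⟨ +-monoˡ-≤ 2 (∑-mono (∖-mono q (∖-mono p bin))) ⟩
  ∑ (((λ _ → 1) ∖ p) ∖ q) + 2       ≡⟨ +-comm _ 2 ⟩
  1 + 1 + ∑ (((λ _ → 1) ∖ p) ∖ q)   ≡⟨ sym (∑-∖∖ (λ _ → 1) p q q≢p) ⟩
  ∑ {n} (λ _ → 1)                   ≡⟨ ∑-ones ⟩
  n                                 ∎
  where open ≤-Reasoning

n≤∑+1 : ∀ {n} (f : Fin n → ℕ) a → (∀ k → k ≢ a → 1 ≤ f k) → n ≤ ∑ f + 1
n≤∑+1 {n} f a pos = begin
  n                         ≡⟨ sym ∑-ones ⟩
  ∑ {n} (λ _ → 1)           ≡⟨ ∑-∖ (λ _ → 1) a ⟩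
  1 + ∑ ((λ _ → 1) ∖ a)     ≤⟨ +-monoʳ-≤ 1 (∑-mono ones≤f) ⟩
  1 + ∑ f                   ≡⟨ +-comm 1 _ ⟩
  ∑ f + 1                   ∎
  where
  open ≤-Reasoning
  ones≤f : ∀ k → ((λ _ → 1) ∖ a) k ≤ f k
  ones≤f k with k F.≟ a
  ... | yes _   = z≤n
  ... | no k≢a  = pos k k≢a

∑-mono-slack-step : ∀ {n} (f g : Fin n → ℕ) l d D →
  f l + d ≤ g l → ∑ (f ∖ l) + D ≤ ∑ (g ∖ l) → ∑ f + d + D ≤ ∑ g
∑-mono-slack-step f g l d D at-l elsewhere = begin
  ∑ f + d + D                          ≡⟨ cong (λ x → x + d + D) (∑-∖ f l) ⟩
  f l + ∑ (f ∖ l) + d + D              ≡⟨ regroup (f l) (∑ (f ∖ l)) d D ⟩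
  (f l + d) + (∑ (f ∖ l) + D)          ≤⟨ +-mono-≤ at-l elsewhere ⟩
  g l + ∑ (g ∖ l)                      ≡⟨ sym (∑-∖ g l) ⟩
  ∑ g                                  ∎
  where
  open ≤-Reasoning
  regroup : ∀ a b c e → a + b + c + e ≡ (a + c) + (b + e)
  regroup = solve-∀

∑-mono-slack : ∀ {n} (f g : Fin n → ℕ) l d → (∀ k → f k ≤ g k) → f l + d ≤ g l → ∑ f + d ≤ ∑ g
∑-mono-slack f g l d f≤g at-l = subst (_≤ ∑ g) (+-identityʳ (∑ f + d))
  (∑-mono-slack-step f g l d 0 at-l (subst (_≤ ∑ (g ∖ l)) (sym (+-identityʳ _)) (∑-mono (∖-mono l f≤g))))

∑-mono-slack₂ : ∀ {n} (f g : Fin n → ℕ) l₁ l₂ d₁ d₂ → l₂ ≢ l₁ → (∀ k → f k ≤ g k) →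
  f l₁ + d₁ ≤ g l₁ → f l₂ + d₂ ≤ g l₂ → ∑ f + d₁ + d₂ ≤ ∑ g
∑-mono-slack₂ f g l₁ l₂ d₁ d₂ l₂≢l₁ f≤g at-l₁ at-l₂ = ∑-mono-slack-step f g l₁ d₁ d₂ at-l₁
  (∑-mono-slack (f ∖ l₁) (g ∖ l₁) l₂ d₂ (∖-mono l₁ f≤g)
    (subst₂ (λ x y → x + d₂ ≤ y) (sym (∖-other f l₂≢l₁)) (sym (∖-other g l₂≢l₁)) at-l₂))

∑-mono-slack₃ : ∀ {n} (f g : Fin n → ℕ) l₁ l₂ l₃ d₁ d₂ d₃ → l₂ ≢ l₁ → l₃ ≢ l₁ → l₃ ≢ l₂ →
  (∀ k → f k ≤ g k) → f l₁ + d₁ ≤ g l₁ → f l₂ + d₂ ≤ g l₂ → f l₃ + d₃ ≤ g l₃ →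
  ∑ f + d₁ + (d₂ + d₃) ≤ ∑ g
∑-mono-slack₃ f g l₁ l₂ l₃ d₁ d₂ d₃ l₂≢l₁ l₃≢l₁ l₃≢l₂ f≤g at-l₁ at-l₂ at-l₃ =
  ∑-mono-slack-step f g l₁ d₁ (d₂ + d₃) at-l₁ (subst (_≤ ∑ (g ∖ l₁)) (+-assoc _ d₂ d₃)
    (∑-mono-slack₂ (f ∖ l₁) (g ∖ l₁) l₂ l₃ d₂ d₃ l₃≢l₂ (∖-mono l₁ f≤g)
      (subst₂ (λ x y → x + d₂ ≤ y) (sym (∖-other f l₂≢l₁)) (sym (∖-other g l₂≢l₁)) at-l₂)
      (subst₂ (λ x y → x + d₃ ≤ y) (sym (∖-other f l₃≢l₁)) (sym (∖-other g l₃≢l₁)) at-l₃)))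

∑≤6 : ∀ {n} (f : Fin n → ℕ) →
  (∀ l → 0 < f l → f l ≤ 6) →
  (∀ l l′ → l ≢ l′ → 0 < f l → 0 < f l′ → f l ≤ 2) →
  (∀ l l₂ l₃ → l₂ ≢ l → l₃ ≢ l → l₃ ≢ l₂ → 0 < f l → 0 < f l₂ → 0 < f l₃ → ⊥) →
  ∑ f ≤ 6
∑≤6 f ≤6 ≤2 no-three with 1 ≤? ∑ f
... | no  ∑≯0 = ≤-trans (≮⇒≥ ∑≯0) z≤n
... | yes ∑>0 with ∑-positive f ∑>0
...   | l , fl>0 with 1 ≤? ∑ (f ∖ l)
...     | no rest≯0 = begin
          ∑ f              ≡⟨ ∑-∖ f l ⟩
          f l + ∑ (f ∖ l)  ≤⟨ +-mono-≤ (≤6 l fl>0) (≮⇒≥ rest≯0) ⟩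
          6 + 0            ∎
  where open ≤-Reasoning
...     | yes rest>0 with ∑-positive (f ∖ l) rest>0
...       | l′ , p with ∖-positive f l l′ p
...         | l′≢l , fl′>0 with 1 ≤? ∑ ((f ∖ l) ∖ l′)
...           | yes rest′>0 = ⊥-elim (third (∑-positive ((f ∖ l) ∖ l′) rest′>0))
  where
  third : (∃ λ k → 0 < ((f ∖ l) ∖ l′) k) → ⊥
  third (k , pk) with ∖-positive (f ∖ l) l′ k pk
  ... | k≢l′ , pk′ with ∖-positive f l k pk′
  ...   | k≢l , fk>0 = no-three l l′ k l′≢l k≢l k≢l′ fl>0 fl′>0 fk>0
...           | no rest′≯0 = begin
          ∑ f                              ≡⟨ ∑-∖∖ f l l′ l′≢l ⟩
          f l + f l′ + ∑ ((f ∖ l) ∖ l′)    ≤⟨ +-mono-≤ (+-mono-≤ (≤2 l l′ (l′≢l ∘ sym) fl>0 fl′>0)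
                                                                 (≤2 l′ l l′≢l fl′>0 fl>0))
                                                       (≮⇒≥ rest′≯0) ⟩
          2 + 2 + 0                        ≤⟨ s≤s (s≤s (s≤s (s≤s z≤n))) ⟩
          6                                ∎
  where open ≤-Reasoning

∑ᴸ : ∀ {A : Set} → List A → (A → ℕ) → ℕ
∑ᴸ []       f = 0
∑ᴸ (x ∷ xs) f = f x + ∑ᴸ xs f

∑ᴸ-cong : ∀ {A : Set} (xs : List A) {f g : A → ℕ} → (∀ x → f x ≡ g x) → ∑ᴸ xs f ≡ ∑ᴸ xs g
∑ᴸ-cong []       h = refl
∑ᴸ-cong (x ∷ xs) h = cong₂ _+_ (h x) (∑ᴸ-cong xs h)

∑ᴸ-mono : ∀ {A : Set} (xs : List A) {f g : A → ℕ} → (∀ x → f x ≤ g x) → ∑ᴸ xs f ≤ ∑ᴸ xs g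
∑ᴸ-mono []       h = z≤n
∑ᴸ-mono (x ∷ xs) h = +-mono-≤ (h x) (∑ᴸ-mono xs h)

∑ᴸ-distrib-+ : ∀ {A : Set} (xs : List A) (f g : A → ℕ) → ∑ᴸ xs (λ x → f x + g x) ≡ ∑ᴸ xs f + ∑ᴸ xs g
∑ᴸ-distrib-+ []       f g = refl
∑ᴸ-distrib-+ (x ∷ xs) f g =
  trans (cong (f x + g x +_) (∑ᴸ-distrib-+ xs f g)) (interchange (f x) (g x) _ _)
  where
  interchange : ∀ a b c d → a + b + (c + d) ≡ a + c + (b + d)
  interchange = solve-∀

∑ᴸ-*ˡ : ∀ {A : Set} (xs : List A) k (f : A → ℕ) → ∑ᴸ xs (λ x → k * f x) ≡ k * ∑ᴸ xs f
∑ᴸ-*ˡ []       k f = sym (*-zeroʳ k)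
∑ᴸ-*ˡ (x ∷ xs) k f = trans (cong (k * f x +_) (∑ᴸ-*ˡ xs k f)) (sym (*-distribˡ-+ k (f x) _))

∑ᴸ-map : ∀ {A B : Set} (g : A → B) (xs : List A) (f : B → ℕ) → ∑ᴸ (L.map g xs) f ≡ ∑ᴸ xs (f ∘ g)
∑ᴸ-map g []       f = refl
∑ᴸ-map g (x ∷ xs) f = cong (f (g x) +_) (∑ᴸ-map g xs f)

∑ᴸ-++ : ∀ {A : Set} (xs ys : List A) (f : A → ℕ) → ∑ᴸ (xs L.++ ys) f ≡ ∑ᴸ xs f + ∑ᴸ ys f
∑ᴸ-++ []       ys f = refl
∑ᴸ-++ (x ∷ xs) ys f = trans (cong (f x +_) (∑ᴸ-++ xs ys f)) (sym (+-assoc (f x) _ _))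

∑ᴸ-∑-comm : ∀ {A : Set} {n} (xs : List A) (h : A → Fin n → ℕ) →
  ∑ᴸ xs (λ u → ∑ (h u)) ≡ ∑ (λ i → ∑ᴸ xs (λ u → h u i))
∑ᴸ-∑-comm {n = n} []       h = sym (∑-zero {n} (λ _ → 0) (λ _ → refl))
∑ᴸ-∑-comm         (x ∷ xs) h =
  trans (cong (∑ (h x) +_) (∑ᴸ-∑-comm xs h)) (sym (∑-distrib-+ (h x) (λ i → ∑ᴸ xs (λ u → h u i))))

∑ᵂ : ∀ n → (Word n → ℕ) → ℕ
∑ᵂ n = ∑ᴸ (allWords n)

∑ᵂ-split : ∀ n (f : Word (suc n) → ℕ) →
  ∑ᵂ (suc n) f ≡ ∑ᵂ n (λ v → f (false ∷ v)) + ∑ᵂ n (λ v → f (true ∷ v))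
∑ᵂ-split n f = trans (∑ᴸ-++ (L.map (false ∷_) (allWords n)) _ f)
  (cong₂ _+_ (∑ᴸ-map (false ∷_) (allWords n) f) (∑ᴸ-map (true ∷_) (allWords n) f))

∑ᵂ-flip : ∀ n (i : Fin n) (f : Word n → ℕ) → ∑ᵂ n (f ∘ flip i) ≡ ∑ᵂ n f
∑ᵂ-flip (suc n) zero f = begin
  ∑ᵂ (suc n) (f ∘ flip zero)                                 ≡⟨ ∑ᵂ-split n _ ⟩
  ∑ᵂ n (λ v → f (true ∷ v)) + ∑ᵂ n (λ v → f (false ∷ v))     ≡⟨ +-comm (∑ᵂ n (λ v → f (true ∷ v))) _ ⟩
  ∑ᵂ n (λ v → f (false ∷ v)) + ∑ᵂ n (λ v → f (true ∷ v))     ≡⟨ sym (∑ᵂ-split n f) ⟩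
  ∑ᵂ (suc n) f                                               ∎
  where open ≡-Reasoning
∑ᵂ-flip (suc n) (suc i) f = begin
  ∑ᵂ (suc n) (f ∘ flip (suc i))                                          ≡⟨ ∑ᵂ-split n _ ⟩
  ∑ᵂ n (λ v → f (false ∷ flip i v)) + ∑ᵂ n (λ v → f (true ∷ flip i v))   ≡⟨ cong₂ _+_
                                                                              (∑ᵂ-flip n i (λ v → f (false ∷ v)))
                                                                              (∑ᵂ-flip n i (λ v → f (true ∷ v))) ⟩
  ∑ᵂ n (λ v → f (false ∷ v)) + ∑ᵂ n (λ v → f (true ∷ v))                 ≡⟨ sym (∑ᵂ-split n f) ⟩
  ∑ᵂ (suc n) f                                                           ∎
  where open ≡-Reasoning

∑ᵂ-ones : ∀ n → ∑ᵂ n (λ _ → 1) ≡ 2 ^ n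
∑ᵂ-ones zero    = refl
∑ᵂ-ones (suc n) = begin
  ∑ᵂ (suc n) (λ _ → 1)                  ≡⟨ ∑ᵂ-split n (λ _ → 1) ⟩
  ∑ᵂ n (λ _ → 1) + ∑ᵂ n (λ _ → 1)       ≡⟨ cong₂ _+_ (∑ᵂ-ones n) (∑ᵂ-ones n) ⟩
  2 ^ n + 2 ^ n                         ≡⟨ cong (2 ^ n +_) (sym (+-identityʳ (2 ^ n))) ⟩
  2 ^ suc n                             ∎
  where open ≡-Reasoning

-- Discharging on the Hamming space

transfers-conserved : ∀ {n} (τ : Fin n → Word n → ℕ) →
  ∑ᵂ n (λ u → ∑ (λ i → τ i (flip i u))) ≡ ∑ᵂ n (λ u → ∑ (λ i → τ i u))
transfers-conserved {n} τ = begin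
  ∑ᵂ n (λ u → ∑ (λ i → τ i (flip i u)))    ≡⟨ ∑ᴸ-∑-comm (allWords n) (λ u i → τ i (flip i u)) ⟩
  ∑ (λ i → ∑ᵂ n (τ i ∘ flip i))            ≡⟨ ∑-cong (λ i → ∑ᵂ-flip n i (τ i)) ⟩
  ∑ (λ i → ∑ᵂ n (τ i))                     ≡⟨ sym (∑ᴸ-∑-comm (allWords n) (λ u i → τ i u)) ⟩
  ∑ᵂ n (λ u → ∑ (λ i → τ i u))             ∎
  where open ≡-Reasoning

discharging : ∀ {n} k (charge : Word n → ℕ) (τ : Fin n → Word n → ℕ) →
  (∀ u → k + ∑ (λ i → τ i u) ≤ charge u + ∑ (λ i → τ i (flip i u))) →
  k * 2 ^ n ≤ ∑ᵂ n charge
discharging {n} k charge τ local = +-cancelʳ-≤ (∑ᵂ n sent) _ _ (begin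
  k * 2 ^ n + ∑ᵂ n sent                    ≡⟨ cong (λ x → k * x + ∑ᵂ n sent) (sym (∑ᵂ-ones n)) ⟩
  k * ∑ᵂ n (λ _ → 1) + ∑ᵂ n sent           ≡⟨ cong (_+ ∑ᵂ n sent) (sym (∑ᴸ-*ˡ (allWords n) k (λ _ → 1))) ⟩
  ∑ᵂ n (λ _ → k * 1) + ∑ᵂ n sent           ≡⟨ cong (_+ ∑ᵂ n sent) (∑ᴸ-cong (allWords n) (λ _ → *-identityʳ k)) ⟩
  ∑ᵂ n (λ _ → k) + ∑ᵂ n sent               ≡⟨ sym (∑ᴸ-distrib-+ (allWords n) (λ _ → k) sent) ⟩
  ∑ᵂ n (λ u → k + sent u)                  ≤⟨ ∑ᴸ-mono (allWords n) local ⟩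
  ∑ᵂ n (λ u → charge u + received u)       ≡⟨ ∑ᴸ-distrib-+ (allWords n) charge received ⟩
  ∑ᵂ n charge + ∑ᵂ n received              ≡⟨ cong (∑ᵂ n charge +_) (transfers-conserved τ) ⟩
  ∑ᵂ n charge + ∑ᵂ n sent                  ∎)
  where
  open ≤-Reasoning
  sent received : Word n → ℕ
  sent     u = ∑ (λ i → τ i u)
  received u = ∑ (λ i → τ i (flip i u))

⟦_⟧ : Bool → ℕ
⟦ true  ⟧ = 1
⟦ false ⟧ = 0

∑ᵂ-indicator≡size : ∀ {n} (C : Code n) → ∑ᵂ n (λ w → ⟦ C w ⟧) ≡ size C
∑ᵂ-indicator≡size {n} C = sym (length-filter (allWords n))
  where
  length-filter : ∀ xs → L.length (L.filter (λ w → C w B.≟ true) xs) ≡ ∑ᴸ xs (λ w → ⟦ C w ⟧)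
  length-filter []       = refl
  length-filter (x ∷ xs) with C x
  ... | true  = cong suc (length-filter xs)
  ... | false = length-filter xs

decide≤ : ∀ {m k} {p : True (m ≤? k)} → m ≤ k
decide≤ {p = p} = toWitness p

guard : Bool → ℕ → ℕ
guard true  x = x
guard false _ = 0

guard-≤ : ∀ b x → guard b x ≤ x
guard-≤ true  x = ≤-refl
guard-≤ false x = z≤n

guard-positive : ∀ b x → 0 < guard b x → b ≡ true × 0 < x
guard-positive true x p = refl , p

guard-0 : ∀ b → guard b 0 ≡ 0
guard-0 true  = refl
guard-0 false = refl

guard-distrib-+ : ∀ b x y → guard b (x + y) ≡ guard b x + guard b y
guard-distrib-+ true  x y = refl
guard-distrib-+ false x y = refl

guard≡*⟦⟧ : ∀ b x → guard b x ≡ x * ⟦ b ⟧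
guard≡*⟦⟧ true  x = sym (*-identityʳ x)
guard≡*⟦⟧ false x = sym (*-zeroʳ x)

guard≤*⟦⟧ : ∀ b {x y} → x ≤ y → guard b x ≤ y * ⟦ b ⟧
guard≤*⟦⟧ b {x} {y} x≤y = ≤-trans (≤-reflexive (guard≡*⟦⟧ b x)) (*-monoˡ-≤ ⟦ b ⟧ x≤y)

∑ᵂ-guard : ∀ {n} (C : Code n) m → ∑ᵂ n (λ w → guard (C w) m) ≡ m * size C
∑ᵂ-guard {n} C m = begin
  ∑ᵂ n (λ w → guard (C w) m)     ≡⟨ ∑ᴸ-cong (allWords n) (λ w → trans (guard≡*⟦⟧ (C w) m) (*-comm m ⟦ C w ⟧)) ⟩
  ∑ᵂ n (λ w → ⟦ C w ⟧ * m)       ≡⟨ ∑ᴸ-cong (allWords n) (λ w → *-comm ⟦ C w ⟧ m) ⟩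
  ∑ᵂ n (λ w → m * ⟦ C w ⟧)       ≡⟨ ∑ᴸ-*ˡ (allWords n) m (λ w → ⟦ C w ⟧) ⟩
  m * ∑ᵂ n (λ w → ⟦ C w ⟧)       ≡⟨ cong (m *_) (∑ᵂ-indicator≡size C) ⟩
  m * size C                      ∎
  where open ≡-Reasoning

⟦⟧≤1 : ∀ b → ⟦ b ⟧ ≤ 1
⟦⟧≤1 true  = ≤-refl
⟦⟧≤1 false = z≤n

⟦⟧-true : ∀ {b} → b ≡ true → ⟦ b ⟧ ≡ 1
⟦⟧-true refl = refl

⟦⟧-false : ∀ {b} → b ≡ false → ⟦ b ⟧ ≡ 0
⟦⟧-false refl = refl

⟦⟧-positive : ∀ {b} → 0 < ⟦ b ⟧ → b ≡ true
⟦⟧-positive {true} _ = refl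

∧≡true⇒ˡ : ∀ {b b′} → b ∧ b′ ≡ true → b ≡ true
∧≡true⇒ˡ {true} _ = refl

not-true : ∀ {b} → not b ≡ true → b ≡ false
not-true {false} _ = refl

isFirst : ∀ {n} → (Fin n → Bool) → Fin n → Bool
isFirst p zero    = p zero
isFirst p (suc i) = not (p zero) ∧ isFirst (p ∘ suc) i

isFirst⇒ : ∀ {n} (p : Fin n → Bool) i → isFirst p i ≡ true → p i ≡ true
isFirst⇒ p zero    e = e
isFirst⇒ p (suc i) e with p zero
... | false = isFirst⇒ (p ∘ suc) i e

∃isFirst : ∀ {n} (p : Fin n → Bool) i → p i ≡ true → ∃ λ k → isFirst p k ≡ true
∃isFirst p zero    e = zero , e
∃isFirst p (suc i) e with p zero in p0
... | true  = zero , p0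
... | false with ∃isFirst (p ∘ suc) i e
...   | k , ek = suc k , trans (cong (λ b → not b ∧ isFirst (p ∘ suc) k) p0) ek

atLeast3 : ℕ → Bool
atLeast3 (suc (suc (suc _))) = true
atLeast3 _                   = false

atLeast3-intro : ∀ t → 3 ≤ t → atLeast3 t ≡ true
atLeast3-intro 1                   (s≤s ())
atLeast3-intro 2                   (s≤s (s≤s ()))
atLeast3-intro (suc (suc (suc t))) _ = refl

atLeast3⇒ : ∀ t → atLeast3 t ≡ true → 3 ≤ t
atLeast3⇒ (suc (suc (suc t))) _ = s≤s (s≤s (s≤s z≤n))

below6 : ℕ → Bool
below6 (suc (suc (suc (suc (suc (suc _)))))) = false
below6 _                                     = true

below6-true : ∀ s → below6 s ≡ true → s < 6
below6-true 0 _ = decide≤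
below6-true 1 _ = decide≤
below6-true 2 _ = decide≤
below6-true 3 _ = decide≤
below6-true 4 _ = decide≤
below6-true 5 _ = decide≤

below6-false : ∀ s → below6 s ≡ false → 6 ≤ s
below6-false (suc (suc (suc (suc (suc (suc s)))))) _ = s≤s (s≤s (s≤s (s≤s (s≤s (s≤s z≤n)))))

loneBonus : ℕ → ℕ
loneBonus 1 = 6
loneBonus _ = 0

loneBonus-* : ∀ t → loneBonus t * t ≡ loneBonus t
loneBonus-* 0             = refl
loneBonus-* 1             = refl
loneBonus-* (suc (suc t)) = refl

loneBonus-≥2 : ∀ t → 2 ≤ t → loneBonus t ≡ 0
loneBonus-≥2 1             (s≤s ())
loneBonus-≥2 (suc (suc t)) _ = refl

isLone : Bool → ℕ → ℕ
isLone false 1 = 1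
isLone _     _ = 0

isLone≤1 : ∀ b t → isLone b t ≤ 1
isLone≤1 false 0             = z≤n
isLone≤1 false 1             = ≤-refl
isLone≤1 false (suc (suc t)) = z≤n
isLone≤1 true  t             = z≤n

isLone-positive : ∀ b t → 0 < isLone b t → b ≡ false × t ≡ 1
isLone-positive false 1 _ = refl , refl

isLone-≢1 : ∀ b t → t ≢ 1 → isLone b t ≡ 0
isLone-≢1 true  t             _   = refl
isLone-≢1 false 0             _   = refl
isLone-≢1 false 1             t≢1 = ⊥-elim (t≢1 refl)
isLone-≢1 false (suc (suc t)) _   = refl

guard-loneBonus : ∀ b t → guard (not b) (loneBonus t) ≡ 6 * isLone b t
guard-loneBonus true  t             = refl
guard-loneBonus false 0             = refl
guard-loneBonus false 1             = refl
guard-loneBonus false (suc (suc t)) = refl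

isNeedy : Bool → ℕ → ℕ → Bool
isNeedy true zero (suc _) = true
isNeedy _    _    _       = false

isNeedy-true : ∀ b t p → isNeedy b t p ≡ true → b ≡ true × t ≡ 0 × 1 ≤ p
isNeedy-true true zero (suc p) _ = refl , refl , s≤s z≤n

isGenerous : Bool → ℕ → ℕ → Bool
isGenerous true (suc _) zero = true
isGenerous _    _       _    = false

isGenerous-intro : ∀ b t p → b ≡ true → 1 ≤ t → p ≡ 0 → isGenerous b t p ≡ true
isGenerous-intro true (suc t) zero _ _ _ = refl

isGenerous-true : ∀ b t p → isGenerous b t p ≡ true → b ≡ true × 1 ≤ t × p ≡ 0
isGenerous-true true (suc t) zero _ = refl , s≤s z≤n , refl

giveCase : Bool → Bool → Bool → ℕ → ℕ
giveCase true  true  true  _ = 6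
giveCase true  _     _     x = x
giveCase false _     _     _ = 0

giveCase-≤ : ∀ needy starved big x → (starved ≡ true → big ≡ true → ⊥) → giveCase needy starved big x ≤ x
giveCase-≤ true  true  true  x h = ⊥-elim (h refl refl)
giveCase-≤ true  true  false x h = ≤-refl
giveCase-≤ true  false big   x h = ≤-refl
giveCase-≤ false st    big   x h = z≤n

giveCase-≤6 : ∀ needy starved big x → x ≤ 6 → giveCase needy starved big x ≤ 6
giveCase-≤6 true  true  true  x h = ≤-refl
giveCase-≤6 true  true  false x h = h
giveCase-≤6 true  false big   x h = h
giveCase-≤6 false st    big   x h = z≤n

transferCase : Bool → Bool → ℕ → ℕ → ℕ
transferCase true  false a _ = a
transferCase false true  _ b = b
transferCase _     _     _ _ = 0

transferCase-from-noncode : ∀ b a x → transferCase false b a x ≡ guard b x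
transferCase-from-noncode true  a x = refl
transferCase-from-noncode false a x = refl

transferCase-to-noncode : ∀ b a x → transferCase b false a x ≡ guard b a
transferCase-to-noncode true  a x = refl
transferCase-to-noncode false a x = refl

transferCase-from-code : ∀ b a x → transferCase true b a x ≡ guard (not b) a
transferCase-from-code true  a x = refl
transferCase-from-code false a x = refl

transferCase-to-code : ∀ b a x → transferCase b true a x ≡ guard (not b) x
transferCase-to-code true  a x = refl
transferCase-to-code false a x = refl

module Scheme {n : ℕ} (C : Code n) where

  deg : Word n → ℕ
  deg u = ∑ (λ i → ⟦ C (flip i u) ⟧)

  -- The value 2 at the hub degree n − 1 is what bounds the payments of a generous codeword
  -- adjacent to several hubs.
  share : ℕ → ℕ
  share 3 = 2
  share 4 = 3
  share 5 = 3
  share t@(suc (suc (suc (suc (suc (suc _)))))) = if t ≡ᵇ n ∸ 1 then 2 else 4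
  share _ = 0

  lone : Word n → ℕ
  lone u = isLone (C u) (deg u)

  loneNbrs : Word n → ℕ
  loneNbrs c = ∑ (λ i → lone (flip i c))

  needy : Word n → Bool
  needy c = isNeedy (C c) (deg c) (loneNbrs c)

  offer : Word n → ℕ
  offer u = guard (not (C u)) (share (deg u))

  offered : Word n → ℕ
  offered c = ∑ (λ i → offer (flip i c))

  starved : Word n → Bool
  starved c = needy c ∧ below6 (offered c)

  give : Word n → Word n → ℕ
  give u c = giveCase (needy c) (starved c) (atLeast3 (deg u)) (share (deg u))

  given : Word n → ℕ
  given u = ∑ (λ i → guard (C (flip i u)) (give u (flip i u)))

  deficit : Word n → ℕ
  deficit u = (12 + given u) ∸ (6 * deg u + loneBonus (deg u))

  generous : Word n → Bool
  generous d = isGenerous (C d) (deg d) (loneNbrs d)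

  settle : Fin n → Word n → ℕ
  settle i v = guard (isFirst (λ k → generous (flip k v)) i) (deficit v)

  transfer : Fin n → Word n → ℕ
  transfer i u = transferCase (C u) (C (flip i u))
    (6 + loneBonus (deg (flip i u)) + settle i (flip i u)) (give u (flip i u))

  charge : Word n → ℕ
  charge u = guard (C u) (6 * n + 12)

  sent received : Word n → ℕ
  sent     u = ∑ (λ i → transfer i u)
  received u = ∑ (λ i → transfer i (flip i u))

module Analysis {n : ℕ} (C : Code n) (ld : IsLocatingDominating C) (10≤n : 10 ≤ n) where
  open Scheme C

  inC : Word n → Fin n → ℕ
  inC u i = ⟦ C (flip i u) ⟧

  inC-binary : ∀ u → Binary (inC u)
  inC-binary u i = ⟦⟧≤1 _

  deg≥1 : ∀ u i → C (flip i u) ≡ true → 1 ≤ deg u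
  deg≥1 u i ci = ≤-trans (≤-reflexive (sym (⟦⟧-true ci))) (≤∑ (inC u) i)

  deg≥2 : ∀ u i k → i ≢ k → C (flip i u) ≡ true → C (flip k u) ≡ true → 2 ≤ deg u
  deg≥2 u i k i≢k ci ck =
    ≤-trans (≤-reflexive (sym (cong₂ _+_ (⟦⟧-true ci) (⟦⟧-true ck)))) (pair≤∑ (inC u) i k i≢k)

  deg≥3 : ∀ u i k l → i ≢ k → i ≢ l → k ≢ l →
          C (flip i u) ≡ true → C (flip k u) ≡ true → C (flip l u) ≡ true → 3 ≤ deg u
  deg≥3 u i k l i≢k i≢l k≢l ci ck cl =
    ≤-trans (≤-reflexive (sym (cong₂ _+_ (cong₂ _+_ (⟦⟧-true ci) (⟦⟧-true ck)) (⟦⟧-true cl))))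
            (triple≤∑ (inC u) i k l i≢k i≢l k≢l)

  deg≡1⇒unique : ∀ u i k → deg u ≡ 1 → C (flip i u) ≡ true → C (flip k u) ≡ true → i ≡ k
  deg≡1⇒unique u i k deg≡1 ci ck with i F.≟ k
  ... | yes i≡k = i≡k
  ... | no  i≢k = ⊥-elim (1+n≰n (≤-trans (deg≥2 u i k i≢k ci ck) (≤-reflexive deg≡1)))

  deg≡0⇒isolated : ∀ c → deg c ≡ 0 → ∀ i → C (flip i c) ≡ false
  deg≡0⇒isolated c deg≡0 i with C (flip i c) in ci
  ... | false = refl
  ... | true  = ⊥-elim (1+n≰n (≤-trans (deg≥1 c i ci) (≤-reflexive deg≡0)))

  ∃nbr : ∀ u → 1 ≤ deg u → ∃ λ k → C (flip k u) ≡ true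
  ∃nbr u 1≤deg with ∑-positive (inC u) 1≤deg
  ... | k , p = k , ⟦⟧-positive p

  ∃nbr-avoiding : ∀ u p → 2 ≤ deg u → ∃ λ k → k ≢ p × C (flip k u) ≡ true
  ∃nbr-avoiding u p 2≤deg with positive-avoiding (inC u) p (inC-binary u p) 2≤deg
  ... | k , k≢p , q = k , k≢p , ⟦⟧-positive q

  ∃nbr-avoiding₂ : ∀ u p q → q ≢ p → 3 ≤ deg u → ∃ λ k → k ≢ p × k ≢ q × C (flip k u) ≡ true
  ∃nbr-avoiding₂ u p q q≢p 3≤deg with positive-avoiding₂ (inC u) (inC-binary u) p q q≢p 3≤deg
  ... | k , k≢p , k≢q , r = k , k≢p , k≢q , ⟦⟧-positive r

  deg+1≤n : ∀ u a → C (flip a u) ≡ false → deg u + 1 ≤ n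
  deg+1≤n u a ca = ∑+1≤n (inC u) (inC-binary u) a (⟦⟧-false ca)

  deg+2≤n : ∀ u p q → q ≢ p → C (flip p u) ≡ false → C (flip q u) ≡ false → deg u + 2 ≤ n
  deg+2≤n u p q q≢p cp cq = ∑+2≤n (inC u) (inC-binary u) p q q≢p (⟦⟧-false cp) (⟦⟧-false cq)

  n≤deg+1 : ∀ u a → (∀ k → k ≢ a → C (flip k u) ≡ true) → n ≤ deg u + 1
  n≤deg+1 u a full = n≤∑+1 (inC u) a (λ k k≢a → ≤-reflexive (sym (⟦⟧-true (full k k≢a))))

  n≤deg+1⇒full : ∀ u a → C (flip a u) ≡ false → n ≤ deg u + 1 → ∀ k → k ≢ a → C (flip k u) ≡ true
  n≤deg+1⇒full u a ca n≤deg+1 k k≢a with C (flip k u) in ck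
  ... | true  = refl
  ... | false = ⊥-elim (1+n≰n (+-cancelˡ-≤ (deg u) 2 1 (≤-trans (deg+2≤n u a k k≢a ca ck) n≤deg+1)))

  codeword-nbr : ∀ u w → C u ≡ false → C w ≡ true → dist u w ≤ 1 → ∃ λ k → w ≡ flip k u
  codeword-nbr u w cu cw d with dist≤1⇒≡⊎flip u w d
  ... | inj₁ refl = ⊥-elim (not-¬ cw cu)
  ... | inj₂ r    = r

  dominated : ∀ u → C u ≡ false → 1 ≤ deg u
  dominated u cu with proj₁ ld u
  ... | w , cw , d with codeword-nbr u w cu cw d
  ...   | k , refl = deg≥1 u k cw

  I-single : ∀ u k → C u ≡ false → deg u ≡ 1 → C (flip k u) ≡ true →
             ∀ w → C w ≡ true → dist u w ≤ 1 → w ≡ flip k u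
  I-single u k cu deg≡1 ck w cw d with codeword-nbr u w cu cw d
  ... | k′ , refl = cong (λ i → flip i u) (deg≡1⇒unique u k′ k deg≡1 cw ck)

  I-pair : ∀ u k₁ k₂ → C u ≡ false → deg u ≡ 2 → k₁ ≢ k₂ → C (flip k₁ u) ≡ true → C (flip k₂ u) ≡ true →
           ∀ w → C w ≡ true → dist u w ≤ 1 → w ≡ flip k₁ u ⊎ w ≡ flip k₂ u
  I-pair u k₁ k₂ cu deg≡2 k₁≢k₂ c₁ c₂ w cw d with codeword-nbr u w cu cw d
  ... | k , refl with k F.≟ k₁ | k F.≟ k₂
  ...   | yes refl | _        = inj₁ refl
  ...   | no _     | yes refl = inj₂ refl
  ...   | no k≢k₁  | no k≢k₂  =
    ⊥-elim (1+n≰n (≤-trans (deg≥3 u k k₁ k₂ k≢k₁ k≢k₂ k₁≢k₂ cw c₁ c₂) (≤-reflexive deg≡2)))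

  no-twin-singles : ∀ u v k m → C u ≡ false → C v ≡ false → u ≢ v → deg u ≡ 1 → deg v ≡ 1 →
                    C (flip k u) ≡ true → flip k u ≡ flip m v → ⊥
  no-twin-singles u v k m cu cv u≢v deg-u deg-v ck same = proj₂ ld u v cu cv u≢v (λ w → mk⇔ (to w) (from w))
    where
    cm : C (flip m v) ≡ true
    cm = trans (cong C (sym same)) ck
    to : ∀ w → InI C u w → InI C v w
    to w (cw , d) = cw , subst (λ z → dist v z ≤ 1) (sym (trans (I-single u k cu deg-u ck w cw d) same))
                              (dist-flip≤1 m v)
    from : ∀ w → InI C v w → InI C u w
    from w (cw , d) = cw , subst (λ z → dist u z ≤ 1) (sym (trans (I-single v m cv deg-v cm w cw d) (sym same)))
                                (dist-flip≤1 k u)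

  no-twin-pairs : ∀ u v k₁ k₂ m₁ m₂ → C u ≡ false → C v ≡ false → u ≢ v → deg u ≡ 2 → deg v ≡ 2 → k₁ ≢ k₂ →
                  C (flip k₁ u) ≡ true → C (flip k₂ u) ≡ true → flip k₁ u ≡ flip m₁ v → flip k₂ u ≡ flip m₂ v → ⊥
  no-twin-pairs u v k₁ k₂ m₁ m₂ cu cv u≢v deg-u deg-v k₁≢k₂ c₁ c₂ same₁ same₂ =
    proj₂ ld u v cu cv u≢v (λ w → mk⇔ (to w) (from w))
    where
    m₁≢m₂ : m₁ ≢ m₂
    m₁≢m₂ m₁≡m₂ = k₁≢k₂ (flip-injectiveˡ k₁ k₂ u (trans same₁ (trans (cong (λ z → flip z v) m₁≡m₂) (sym same₂))))
    d₁ : C (flip m₁ v) ≡ true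
    d₁ = trans (cong C (sym same₁)) c₁
    d₂ : C (flip m₂ v) ≡ true
    d₂ = trans (cong C (sym same₂)) c₂
    to : ∀ w → InI C u w → InI C v w
    to w (cw , d) with I-pair u k₁ k₂ cu deg-u k₁≢k₂ c₁ c₂ w cw d
    ... | inj₁ r = cw , subst (λ z → dist v z ≤ 1) (sym (trans r same₁)) (dist-flip≤1 m₁ v)
    ... | inj₂ r = cw , subst (λ z → dist v z ≤ 1) (sym (trans r same₂)) (dist-flip≤1 m₂ v)
    from : ∀ w → InI C v w → InI C u w
    from w (cw , d) with I-pair v m₁ m₂ cv deg-v m₁≢m₂ d₁ d₂ w cw d
    ... | inj₁ r = cw , subst (λ z → dist u z ≤ 1) (sym (trans r (sym same₁))) (dist-flip≤1 k₁ u)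
    ... | inj₂ r = cw , subst (λ z → dist u z ≤ 1) (sym (trans r (sym same₂))) (dist-flip≤1 k₂ u)

  loneNbrs≤1 : ∀ c → C c ≡ true → loneNbrs c ≤ 1
  loneNbrs≤1 c cc with 2 ≤? loneNbrs c
  ... | no  2≰ = s≤s⁻¹ (≰⇒> 2≰)
  ... | yes 2≤ with two-positive (λ i → lone (flip i c)) (λ i → isLone≤1 _ _) 2≤
  ...   | i , k , i≢k , li , lk with isLone-positive _ _ li | isLone-positive _ _ lk
  ...     | ci , deg-i | ck , deg-k = ⊥-elim (no-twin-singles (flip i c) (flip k c) i k ci ck
              (i≢k ∘ flip-injectiveˡ i k c) deg-i deg-k
              (trans (cong C (flip-involutive i c)) cc) (trans (flip-involutive i c) (sym (flip-involutive k c))))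

  share-above5 : ∀ t → 6 ≤ t → share t ≡ (if t ≡ᵇ n ∸ 1 then 2 else 4)
  share-above5 t (s≤s (s≤s (s≤s (s≤s (s≤s (s≤s _)))))) = refl

  n∸1≥9 : 9 ≤ n ∸ 1
  n∸1≥9 = ∸-monoˡ-≤ 1 10≤n

  share-top : share (n ∸ 1) ≡ 2
  share-top = begin
    share (n ∸ 1)                                ≡⟨ share-above5 (n ∸ 1) (≤-trans decide≤ n∸1≥9) ⟩
    (if (n ∸ 1) ≡ᵇ (n ∸ 1) then 2 else 4)        ≡⟨ cong (if_then 2 else 4)
                                                      (Equivalence.to T-≡ (≡⇒≡ᵇ (n ∸ 1) (n ∸ 1) refl)) ⟩
    2                                            ∎
    where open ≡-Reasoning

  share-mid : ∀ t → 6 ≤ t → t + 2 ≤ n → share t ≡ 4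
  share-mid t 6≤t t+2≤n with t ≡ᵇ n ∸ 1 in t≟
  ... | false = trans (share-above5 t 6≤t) (cong (if_then 2 else 4) t≟)
  ... | true  = ⊥-elim (1+n≰n (begin-strict
      n                ≡⟨ sym (m∸n+n≡m (≤-trans (s≤s z≤n) 10≤n)) ⟩
      n ∸ 1 + 1        ≡⟨ cong (_+ 1) (sym (≡ᵇ⇒≡ t (n ∸ 1) (Equivalence.from T-≡ t≟))) ⟩
      t + 1            <⟨ +-monoʳ-< t ≤-refl ⟩
      t + 2            ≤⟨ t+2≤n ⟩
      n                ∎))
    where open ≤-Reasoning

  share≤4 : ∀ t → share t ≤ 4
  share≤4 0 = z≤n
  share≤4 1 = z≤n
  share≤4 2 = z≤n
  share≤4 3 = decide≤
  share≤4 4 = decide≤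
  share≤4 5 = decide≤
  share≤4 t@(suc (suc (suc (suc (suc (suc _)))))) with t ≡ᵇ n ∸ 1
  ... | true  = decide≤
  ... | false = ≤-refl

  share≥2 : ∀ t → 3 ≤ t → 2 ≤ share t
  share≥2 1 (s≤s ())
  share≥2 2 (s≤s (s≤s ()))
  share≥2 3 _ = ≤-refl
  share≥2 4 _ = decide≤
  share≥2 5 _ = decide≤
  share≥2 t@(suc (suc (suc (suc (suc (suc _)))))) _ with t ≡ᵇ n ∸ 1
  ... | true  = ≤-refl
  ... | false = decide≤

  share≥3 : ∀ t → 4 ≤ t → t + 2 ≤ n → 3 ≤ share t
  share≥3 1 (s≤s ()) _
  share≥3 2 (s≤s (s≤s ())) _
  share≥3 3 (s≤s (s≤s (s≤s ()))) _
  share≥3 4 _ _ = ≤-refl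
  share≥3 5 _ _ = ≤-refl
  share≥3 t@(suc (suc (suc (suc (suc (suc _)))))) _ t+2≤n =
    ≤-trans decide≤ (≤-reflexive (sym (share-mid t decide≤ t+2≤n)))

  partner≥ : ∀ {t₁ t₂} b k → n ≤ t₁ + t₂ + 1 → t₁ ≤ b → b + k ≡ 9 → k ≤ t₂
  partner≥ {t₁} {t₂} b k n≤t₁+t₂+1 t₁≤b b+k≡9 = +-cancelˡ-≤ (b + 1) k t₂ (begin
    b + 1 + k       ≡⟨ trans (+-assoc b 1 k) (trans (+-suc b k) (cong suc b+k≡9)) ⟩
    10              ≤⟨ ≤-trans 10≤n n≤t₁+t₂+1 ⟩
    t₁ + t₂ + 1     ≤⟨ +-monoˡ-≤ 1 (+-monoˡ-≤ t₂ t₁≤b) ⟩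
    b + t₂ + 1      ≡⟨ swap b t₂ ⟩
    b + 1 + t₂      ∎)
    where
    open ≤-Reasoning
    swap : ∀ x y → x + y + 1 ≡ x + 1 + y
    swap = solve-∀

  share-pair : ∀ t₁ t₂ → 3 ≤ t₁ → 3 ≤ t₂ → t₁ + 2 ≤ n → t₂ + 2 ≤ n → n ≤ t₁ + t₂ + 1 →
               6 ≤ share t₁ + share t₂
  share-pair t₁ t₂ 3≤t₁ 3≤t₂ t₁+2≤n t₂+2≤n n≤t₁+t₂+1 with 6 ≤? t₁ | 4 ≤? t₁
  ... | yes 6≤t₁ | _      = +-mono-≤ {4} {_} {2} (≤-reflexive (sym (share-mid t₁ 6≤t₁ t₁+2≤n))) (share≥2 t₂ 3≤t₂)
  ... | no  6≰t₁ | yes 4≤t₁ = +-mono-≤ {3} {_} {3} (share≥3 t₁ 4≤t₁ t₁+2≤n) (share≥3 t₂ (partner≥ 5 4 n≤t₁+t₂+1 (≮⇒≥ 6≰t₁) refl) t₂+2≤n)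
  ... | no  _    | no 4≰t₁  = +-mono-≤ {2} {_} {4} (share≥2 t₁ 3≤t₁)
                                (≤-reflexive (sym (share-mid t₂ (partner≥ 3 6 n≤t₁+t₂+1 (≮⇒≥ 4≰t₁) refl) t₂+2≤n)))

  share-budget : ∀ t → 1 ≤ t → 12 + t * share t ≤ 6 * t + loneBonus t
  share-budget 1 _ = decide≤
  share-budget 2 _ = decide≤
  share-budget 3 _ = decide≤
  share-budget 4 _ = decide≤
  share-budget 5 _ = decide≤
  share-budget t@(suc (suc (suc (suc (suc (suc _)))))) _ = begin
    12 + t * share t  ≤⟨ +-monoʳ-≤ 12 (*-monoʳ-≤ t (share≤4 t)) ⟩
    12 + t * 4        ≤⟨ +-monoˡ-≤ (t * 4) (*-monoˡ-≤ 2 {6} {t} decide≤) ⟩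
    t * 2 + t * 4     ≡⟨ sym (*-distribˡ-+ t 2 4) ⟩
    t * 6             ≡⟨ *-comm t 6 ⟩
    6 * t             ≡⟨ sym (+-identityʳ (6 * t)) ⟩
    6 * t + 0         ∎
    where open ≤-Reasoning

  -- Starved codewords and hubs

  ∃-other : ∀ {m} → 2 ≤ m → (a : Fin m) → ∃ λ i → i ≢ a
  ∃-other {suc zero}    (s≤s ()) zero
  ∃-other {suc (suc m)} _ zero    = suc zero , λ ()
  ∃-other {suc (suc m)} _ (suc a) = zero , λ ()

  ≤2∧≥2⇒≡2 : ∀ {t} → 2 ≤ t → ¬ 3 ≤ t → t ≡ 2
  ≤2∧≥2⇒≡2 2≤t 3≰t = ≤-antisym (≮⇒≥ 3≰t) 2≤t

  -- flip a c is the lone neighbour of c and flip j c its hub.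
  record StarvedShape (c : Word n) : Set where
    field
      a j         : Fin n
      a≢j         : a ≢ j
      codeword    : C c ≡ true
      isolated    : ∀ i → C (flip i c) ≡ false
      deg-a       : deg (flip a c) ≡ 1
      deg-j       : deg (flip j c) + 1 ≡ n
      deg-others  : ∀ i → i ≢ a → i ≢ j → deg (flip i c) ≡ 2
      j-full      : ∀ i → i ≢ a → C (flip i (flip j c)) ≡ true

  module Starved (c : Word n) (starved-c : starved c ≡ true) where
    needy-c : needy c ≡ true
    needy-c = ∧≡true⇒ˡ starved-c

    offered<6 : offered c < 6
    offered<6 = below6-true (offered c) (trans (cong (λ b → b ∧ below6 (offered c)) (sym needy-c)) starved-c)

    code-c : C c ≡ true
    code-c = proj₁ (isNeedy-true _ _ _ needy-c)

    isolated-c : ∀ i → C (flip i c) ≡ false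
    isolated-c = deg≡0⇒isolated c (proj₁ (proj₂ (isNeedy-true _ _ _ needy-c)))

    nb : Fin n → Word n
    nb i = flip i c

    δ : Fin n → ℕ
    δ i = deg (nb i)

    code-back : ∀ i → C (flip i (nb i)) ≡ true
    code-back i = trans (cong C (flip-involutive i c)) code-c

    lone-dir : ∃ λ a → 0 < lone (nb a)
    lone-dir = ∑-positive _ (proj₂ (proj₂ (isNeedy-true _ _ _ needy-c)))

    a : Fin n
    a = proj₁ lone-dir

    δa≡1 : δ a ≡ 1
    δa≡1 = proj₂ (isLone-positive _ _ (proj₂ lone-dir))

    offered≡ : offered c ≡ ∑ (share ∘ δ)
    offered≡ = ∑-cong (λ i → cong (λ b → guard (not b) (share (δ i))) (isolated-c i))

    away-from-a : ∀ i → i ≢ a → C (flip a (nb i)) ≡ false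
    away-from-a i i≢a with C (flip a (nb i)) in ca
    ... | false = refl
    ... | true  = ⊥-elim (i≢a (sym (deg≡1⇒unique (nb a) a i δa≡1 (code-back a)
                                  (trans (cong C (flip-comm i a c)) ca))))

    δ≥2 : ∀ i → i ≢ a → 2 ≤ δ i
    δ≥2 i i≢a = ≤∧≢⇒< (deg≥1 (nb i) i (code-back i)) δi≢1
      where
      δi≢1 : 1 ≢ δ i
      δi≢1 1≡δi = 1+n≰n (begin
        2                             ≡⟨ cong₂ _+_ (sym (cong₂ isLone (proj₁ (isLone-positive _ _ (proj₂ lone-dir))) δa≡1))
                                                   (sym (cong₂ isLone (isolated-c i) (sym 1≡δi))) ⟩
        lone (nb a) + lone (nb i)     ≤⟨ pair≤∑ (λ k → lone (nb k)) a i (i≢a ∘ sym) ⟩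
        loneNbrs c                    ≤⟨ loneNbrs≤1 c code-c ⟩
        1                             ∎)
        where open ≤-Reasoning

    δ+1≤n : ∀ i → i ≢ a → δ i + 1 ≤ n
    δ+1≤n i i≢a = deg+1≤n (nb i) a (away-from-a i i≢a)

    -- A neighbour of degree 2 shares c with its second codeword, so by the locating property the
    -- neighbour of c lying under that codeword must have degree at least 3.
    partner : ∀ i → i ≢ a → δ i ≡ 2 → ∃ λ m → m ≢ i × m ≢ a × C (flip m (nb i)) ≡ true × 3 ≤ δ m
    partner i i≢a δi≡2 with ∃nbr-avoiding (nb i) i (≤-reflexive (sym δi≡2))
    ... | m , m≢i , cm = m , m≢i , m≢a , cm , big
      where
      m≢a : m ≢ a
      m≢a refl = not-¬ cm (away-from-a i i≢a)
      big : 3 ≤ δ m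
      big with 3 ≤? δ m
      ... | yes 3≤δm = 3≤δm
      ... | no  3≰δm = ⊥-elim (no-twin-pairs (nb i) (nb m) i m m i (isolated-c i) (isolated-c m)
                         (m≢i ∘ sym ∘ flip-injectiveˡ i m c) δi≡2 (≤2∧≥2⇒≡2 (δ≥2 m m≢a) 3≰δm) (m≢i ∘ sym)
                         (code-back i) cm (trans (flip-involutive i c) (sym (flip-involutive m c))) (flip-comm m i c))

    no-three-big : ∀ i k l → i ≢ k → i ≢ l → k ≢ l → 3 ≤ δ i → 3 ≤ δ k → 3 ≤ δ l → ⊥
    no-three-big i k l i≢k i≢l k≢l 3≤δi 3≤δk 3≤δl = <⇒≱ offered<6 (begin
      6                                       ≤⟨ +-mono-≤ (+-mono-≤ (share≥2 (δ i) 3≤δi) (share≥2 (δ k) 3≤δk))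
                                                                     (share≥2 (δ l) 3≤δl) ⟩
      share (δ i) + share (δ k) + share (δ l) ≤⟨ triple≤∑ (share ∘ δ) i k l i≢k i≢l k≢l ⟩
      ∑ (share ∘ δ)                           ≡⟨ sym offered≡ ⟩
      offered c                               ∎)
      where open ≤-Reasoning

    some-big : (∀ v → v ≢ a → ¬ 3 ≤ δ v) → ⊥
    some-big none with ∃-other (≤-trans decide≤ 10≤n) a
    ... | i , i≢a with partner i i≢a (≤2∧≥2⇒≡2 (δ≥2 i i≢a) (none i i≢a))
    ...   | m , _ , m≢a , _ , 3≤δm = none m m≢a 3≤δm

    module OneBig (v : Fin n) (v≢a : v ≢ a) (3≤δv : 3 ≤ δ v)
                  (only : ∀ v′ → v′ ≢ a → v′ ≢ v → ¬ 3 ≤ δ v′) where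
      δ≡2 : ∀ i → i ≢ a → i ≢ v → δ i ≡ 2
      δ≡2 i i≢a i≢v = ≤2∧≥2⇒≡2 (δ≥2 i i≢a) (only i i≢a i≢v)

      v-full : ∀ i → i ≢ a → C (flip i (nb v)) ≡ true
      v-full i i≢a with i F.≟ v
      ... | yes refl = code-back i
      ... | no  i≢v with partner i i≢a (δ≡2 i i≢a i≢v)
      ...   | m , _ , m≢a , cm , 3≤δm with m F.≟ v
      ...     | yes refl = trans (cong C (flip-comm i m c)) cm
      ...     | no  m≢v  = ⊥-elim (only m m≢a m≢v 3≤δm)

      shape : StarvedShape c
      shape = record
        { a = a ; j = v ; a≢j = v≢a ∘ sym ; codeword = code-c ; isolated = isolated-c ; deg-a = δa≡1
        ; deg-j = ≤-antisym (δ+1≤n v v≢a) (n≤deg+1 (nb v) a v-full)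
        ; deg-others = δ≡2 ; j-full = v-full }

    module TwoBig (v : Fin n) (v≢a : v ≢ a) (3≤δv : 3 ≤ δ v)
                  (v′ : Fin n) (v′≢a : v′ ≢ a) (v′≢v : v′ ≢ v) (3≤δv′ : 3 ≤ δ v′) where
      no-third : ∀ w → w ≢ a → w ≢ v → w ≢ v′ → ¬ 3 ≤ δ w
      no-third w _ w≢v w≢v′ = no-three-big v v′ w (v′≢v ∘ sym) (w≢v ∘ sym) (w≢v′ ∘ sym) 3≤δv 3≤δv′

      -- If nb y had n − 1 codeword neighbours, a codeword flip m (nb y′) with m ∉ {y, y′} would make
      -- nb m adjacent to the codewords c, flip m (nb y) and flip m (nb y′): a third big neighbour.
      not-full : ∀ y y′ → y ≢ a → y′ ≢ a → y′ ≢ y → 3 ≤ δ y′ →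
                 (∀ w → w ≢ a → w ≢ y → w ≢ y′ → ¬ 3 ≤ δ w) → δ y + 2 ≤ n
      not-full y y′ y≢a y′≢a y′≢y 3≤δy′ no-third′ with δ y + 2 ≤? n
      ... | yes δy+2≤n = δy+2≤n
      ... | no  δy+2≰n with ∃nbr-avoiding₂ (nb y′) y′ y (y′≢y ∘ sym) 3≤δy′
      ...   | m , m≢y′ , m≢y , cm = ⊥-elim (no-third′ m m≢a m≢y m≢y′ 3≤δm)
        where
        y-full : ∀ k → k ≢ a → C (flip k (nb y)) ≡ true
        y-full = n≤deg+1⇒full (nb y) a (away-from-a y y≢a)
                   (s≤s⁻¹ (≤-trans (≰⇒> δy+2≰n) (≤-reflexive (+-suc (δ y) 1))))
        m≢a : m ≢ a
        m≢a refl = not-¬ cm (away-from-a y′ y′≢a)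
        3≤δm : 3 ≤ δ m
        3≤δm = deg≥3 (nb m) m y y′ m≢y m≢y′ (y′≢y ∘ sym) (code-back m)
                 (trans (cong C (flip-comm y m c)) (y-full m m≢a)) (trans (cong C (flip-comm y′ m c)) cm)

      covered : ∀ i → i ≢ a → 1 ≤ inC (nb v) i + inC (nb v′) i
      covered i i≢a with i F.≟ v | i F.≟ v′
      ... | yes refl | _        = ≤-trans (≤-reflexive (sym (⟦⟧-true (code-back i)))) (m≤m+n _ _)
      ... | no _     | yes refl = ≤-trans (≤-reflexive (sym (⟦⟧-true (code-back i)))) (m≤n+m _ _)
      ... | no i≢v   | no i≢v′ with partner i i≢a (≤2∧≥2⇒≡2 (δ≥2 i i≢a) (no-third i i≢a i≢v i≢v′))
      ...   | m , _ , m≢a , cm , 3≤δm with m F.≟ v | m F.≟ v′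
      ...     | yes refl | _        = ≤-trans (≤-reflexive (sym (⟦⟧-true (trans (cong C (flip-comm i m c)) cm))))
                                              (m≤m+n _ _)
      ...     | no _     | yes refl = ≤-trans (≤-reflexive (sym (⟦⟧-true (trans (cong C (flip-comm i m c)) cm))))
                                              (m≤n+m _ _)
      ...     | no m≢v   | no m≢v′  = ⊥-elim (no-third m m≢a m≢v m≢v′ 3≤δm)

      n≤δv+δv′+1 : n ≤ δ v + δ v′ + 1
      n≤δv+δv′+1 = begin
        n                                          ≤⟨ n≤∑+1 _ a covered ⟩
        ∑ (λ k → inC (nb v) k + inC (nb v′) k) + 1 ≡⟨ cong (_+ 1) (∑-distrib-+ (inC (nb v)) (inC (nb v′))) ⟩
        δ v + δ v′ + 1                             ∎
        where open ≤-Reasoning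

      impossible : ⊥
      impossible = <⇒≱ offered<6 (begin
        6                        ≤⟨ share-pair (δ v) (δ v′) 3≤δv 3≤δv′
                                      (not-full v v′ v≢a v′≢a v′≢v 3≤δv′ no-third)
                                      (not-full v′ v v′≢a v≢a (v′≢v ∘ sym) 3≤δv (λ w a′ b′ c′ → no-third w a′ c′ b′))
                                      n≤δv+δv′+1 ⟩
        share (δ v) + share (δ v′) ≤⟨ pair≤∑ (share ∘ δ) v v′ (v′≢v ∘ sym) ⟩
        ∑ (share ∘ δ)            ≡⟨ sym offered≡ ⟩
        offered c                ∎)
        where open ≤-Reasoning

    shape : StarvedShape c
    shape with any? (λ v → ¬? (v F.≟ a) ×-dec (3 ≤? δ v))
    ... | no  none = ⊥-elim (some-big (λ v v≢a 3≤δv → none (v , v≢a , 3≤δv)))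
    ... | yes (v , v≢a , 3≤δv) with any? (λ v′ → ¬? (v′ F.≟ a) ×-dec ¬? (v′ F.≟ v) ×-dec (3 ≤? δ v′))
    ...   | yes (v′ , v′≢a , v′≢v , 3≤δv′) = ⊥-elim (TwoBig.impossible v v≢a 3≤δv v′ v′≢a v′≢v 3≤δv′)
    ...   | no  no-other = OneBig.shape v v≢a 3≤δv (λ v′ v′≢a v′≢v 3≤δv′ → no-other (v′ , v′≢a , v′≢v , 3≤δv′))

  starvedShape : ∀ c → starved c ≡ true → StarvedShape c
  starvedShape = Starved.shape

  hub-unique : ∀ c (s : StarvedShape c) k → 3 ≤ deg (flip k c) → k ≡ StarvedShape.j s
  hub-unique c s k 3≤deg with k F.≟ StarvedShape.a s | k F.≟ StarvedShape.j s
  ... | yes refl | _        = ⊥-elim (<⇒≱ (s≤s (s≤s z≤n)) (subst (3 ≤_) (StarvedShape.deg-a s) 3≤deg))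
  ... | no  _    | yes k≡j  = k≡j
  ... | no  k≢a  | no  k≢j  = ⊥-elim (<⇒≱ ≤-refl (subst (3 ≤_) (StarvedShape.deg-others s k k≢a k≢j) 3≤deg))

  IsHub : Word n → Set
  IsHub u = ∃ λ j → starved (flip j u) ≡ true × 3 ≤ deg u

  isHub? : ∀ u → Dec (IsHub u)
  isHub? u = any? (λ j → (starved (flip j u) B.≟ true) ×-dec (3 ≤? deg u))

  -- flip j u is the starved codeword and flip a u the only non-codeword neighbour of u.
  record Hub (u : Word n) : Set where
    field
      a j          : Fin n
      a-noncode    : C (flip a u) ≡ false
      full         : ∀ i → i ≢ a → C (flip i u) ≡ true
      deg≡         : deg u + 1 ≡ n
      starved-j    : starved (flip j u) ≡ true
      lone-a       : ∀ k → k ≢ a → C (flip k (flip a (flip j u))) ≡ false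

  hub : ∀ u → IsHub u → Hub u
  hub u (j , starved-c , 3≤deg) = record
    { a = a ; j = j ; a-noncode = a-noncode ; full = full ; deg≡ = deg≡ ; starved-j = starved-c
    ; lone-a = lone-a }
    where
    c : Word n
    c = flip j u
    s : StarvedShape c
    s = starvedShape c starved-c
    a : Fin n
    a = StarvedShape.a s
    u≡ : u ≡ flip (StarvedShape.j s) c
    u≡ = trans (sym (flip-involutive j u))
               (cong (λ z → flip z c) (hub-unique c s j (subst (λ z → 3 ≤ deg z) (sym (flip-involutive j u)) 3≤deg)))
    deg≡ : deg u + 1 ≡ n
    deg≡ = trans (cong (λ z → deg z + 1) u≡) (StarvedShape.deg-j s)
    full : ∀ i → i ≢ a → C (flip i u) ≡ true
    full i i≢a = trans (cong (λ z → C (flip i z)) u≡) (StarvedShape.j-full s i i≢a)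
    lone-a : ∀ k → k ≢ a → C (flip k (flip a c)) ≡ false
    lone-a k k≢a with C (flip k (flip a c)) in ck
    ... | false = refl
    ... | true  = ⊥-elim (k≢a (deg≡1⇒unique (flip a c) k a (StarvedShape.deg-a s) ck
                                (trans (cong C (flip-involutive a c)) (StarvedShape.codeword s))))
    a-noncode : C (flip a u) ≡ false
    a-noncode = trans (cong (λ z → C (flip a z)) u≡)
                      (trans (cong C (flip-comm a (StarvedShape.j s) c)) (lone-a _ (StarvedShape.a≢j s ∘ sym)))

  -- The generous neighbour is the codeword flip m u covering flip a u: it has flip a (flip m u) as a
  -- codeword neighbour, and none of its neighbours is lone because they have degree ≥ 2 or n − 1.
  hub-generous-nbr : ∀ u → C u ≡ false → Hub u → ∃ λ k → generous (flip k u) ≡ true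
  hub-generous-nbr u cu H = m , generous-d
    where
    open Hub H
    q : Word n
    q = flip a u
    m-dir : ∃ λ m → C (flip m q) ≡ true
    m-dir = ∃nbr q (dominated q a-noncode)
    m : Fin n
    m = proj₁ m-dir
    cm : C (flip m q) ≡ true
    cm = proj₂ m-dir
    m≢a : m ≢ a
    m≢a m≡a = not-¬ cm (trans (cong (λ z → C (flip z q)) m≡a) (trans (cong C (flip-involutive a u)) cu))
    d : Word n
    d = flip m u
    no-lone-nbr : ∀ k → lone (flip k d) ≡ 0
    no-lone-nbr k with k F.≟ m | k F.≟ a
    ... | yes refl | _        = isLone-≢1 _ _ (subst (λ z → deg z ≢ 1) (sym (flip-involutive k u)) n∸1≢1)
      where
      n∸1≢1 : deg u ≢ 1
      n∸1≢1 deg≡1 = 1+n≰n (≤-trans (≤-trans decide≤ 10≤n) (≤-reflexive (trans (sym deg≡) (cong (_+ 1) deg≡1))))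
    ... | no _     | yes refl = cong (λ b → isLone b (deg (flip k d))) (trans (cong C (flip-comm k m u)) cm)
    ... | no k≢m   | no k≢a   = isLone-≢1 _ _ λ deg≡1 → k≢m (deg≡1⇒unique (flip k d) k m deg≡1
                                  (trans (cong C (flip-involutive k d)) (full m m≢a))
                                  (trans (cong C (trans (flip-comm m k d) (cong (flip k) (flip-involutive m u))))
                                         (full k k≢a)))
    generous-d : generous d ≡ true
    generous-d = isGenerous-intro (C d) (deg d) (loneNbrs d) (full m m≢a)
                   (deg≥1 d a (trans (cong C (flip-comm a m u)) cm)) (∑-zero _ no-lone-nbr)

  generous⇒ : ∀ d → generous d ≡ true → C d ≡ true × 1 ≤ deg d × loneNbrs d ≡ 0
  generous⇒ d = isGenerous-true (C d) (deg d) (loneNbrs d)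

  generous⇒¬needy : ∀ d → generous d ≡ true → needy d ≡ false
  generous⇒¬needy d gd with needy d in needy-d
  ... | false = refl
  ... | true  = ⊥-elim (1+n≰n (≤-trans (proj₁ (proj₂ (generous⇒ d gd)))
                                       (≤-reflexive (proj₁ (proj₂ (isNeedy-true _ _ _ needy-d))))))

  give≤6 : ∀ u c → give u c ≤ 6
  give≤6 u c = giveCase-≤6 (needy c) (starved c) (atLeast3 (deg u)) (share (deg u)) (≤-trans (share≤4 (deg u)) decide≤)

  given-nonhub : ∀ u → ¬ IsHub u → given u ≤ deg u * share (deg u)
  given-nonhub u ¬hub = begin
    given u                             ≤⟨ ∑-mono (λ i → guard≤*⟦⟧ (C (flip i u))
                                             (giveCase-≤ (needy (flip i u)) (starved (flip i u)) (atLeast3 (deg u)) _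
                                               (λ st big → ¬hub (i , st , atLeast3⇒ (deg u) big)))) ⟩
    ∑ (λ i → share (deg u) * inC u i)   ≡⟨ ∑-*ˡ (share (deg u)) (inC u) ⟩
    share (deg u) * deg u               ≡⟨ *-comm (share (deg u)) (deg u) ⟩
    deg u * share (deg u)               ∎
    where open ≤-Reasoning

  deficit-nonhub : ∀ u → C u ≡ false → ¬ IsHub u → deficit u ≡ 0
  deficit-nonhub u cu ¬hub = m≤n⇒m∸n≡0
    (≤-trans (+-monoʳ-≤ 12 (given-nonhub u ¬hub)) (share-budget (deg u) (dominated u cu)))

  deficit≤ : ∀ u e → 2 ≤ deg u → 12 + given u ≤ 6 * deg u + e → deficit u ≤ e
  deficit≤ u e 2≤deg budget = begin
    12 + given u ∸ (6 * deg u + loneBonus (deg u))   ≤⟨ ∸-monoˡ-≤ (6 * deg u + loneBonus (deg u)) budget ⟩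
    6 * deg u + e ∸ (6 * deg u + loneBonus (deg u))  ≡⟨ cong (λ z → 6 * deg u + e ∸ (6 * deg u + z))
                                                          (loneBonus-≥2 (deg u) 2≤deg) ⟩
    6 * deg u + e ∸ (6 * deg u + 0)                  ≡⟨ cong (6 * deg u + e ∸_) (+-identityʳ (6 * deg u)) ⟩
    6 * deg u + e ∸ 6 * deg u                        ≡⟨ m+n∸m≡n (6 * deg u) e ⟩
    e                                                ∎
    where open ≤-Reasoning

  givenTo : Word n → Fin n → ℕ
  givenTo u i = guard (C (flip i u)) (give u (flip i u))

  givenTo≤ : ∀ u i → givenTo u i ≤ 6 * inC u i
  givenTo≤ u i = guard≤*⟦⟧ (C (flip i u)) (give≤6 u (flip i u))

  slack-generous : ∀ u l → generous (flip l u) ≡ true → givenTo u l + 6 ≤ 6 * inC u l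
  slack-generous u l gd = ≤-reflexive (begin
    guard (C (flip l u)) (give u (flip l u)) + 6   ≡⟨ cong (λ b → guard (C (flip l u))
                                                        (giveCase b (starved (flip l u)) _ _) + 6)
                                                        (generous⇒¬needy (flip l u) gd) ⟩
    guard (C (flip l u)) 0 + 6                     ≡⟨ cong (_+ 6) (guard-0 (C (flip l u))) ⟩
    6                                              ≡⟨ cong (6 *_) (sym (⟦⟧-true (proj₁ (generous⇒ (flip l u) gd)))) ⟩
    6 * inC u l                                    ∎)
    where open ≡-Reasoning

  slack-small : ∀ u l → C (flip l u) ≡ true → give u (flip l u) ≤ 2 → givenTo u l + 4 ≤ 6 * inC u l
  slack-small u l cl give≤2 = begin
    givenTo u l + 4                ≡⟨ cong (λ b → guard b (give u (flip l u)) + 4) cl ⟩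
    give u (flip l u) + 4          ≤⟨ +-monoˡ-≤ 4 give≤2 ⟩
    6                              ≡⟨ cong (6 *_) (sym (⟦⟧-true cl)) ⟩
    6 * inC u l                    ∎
    where open ≤-Reasoning

  ∑6inC : ∀ u → ∑ (λ i → 6 * inC u i) ≡ 6 * deg u
  ∑6inC u = ∑-*ˡ 6 (inC u)

  deficit≤6 : ∀ u l → 3 ≤ deg u → generous (flip l u) ≡ true → deficit u ≤ 6
  deficit≤6 u l 3≤deg gd = deficit≤ u 6 (≤-trans decide≤ 3≤deg) (begin
    12 + ∑ (givenTo u)                 ≡⟨ regroup (∑ (givenTo u)) ⟩
    ∑ (givenTo u) + 6 + 6              ≤⟨ +-monoˡ-≤ 6 (∑-mono-slack (givenTo u) _ l 6 (givenTo≤ u) (slack-generous u l gd)) ⟩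
    ∑ (λ i → 6 * inC u i) + 6          ≡⟨ cong (_+ 6) (∑6inC u) ⟩
    6 * deg u + 6                      ∎)
    where
    open ≤-Reasoning
    regroup : ∀ x → 12 + x ≡ x + 6 + 6
    regroup = solve-∀

  deficit≤2 : ∀ u l l₂ → l₂ ≢ l → 3 ≤ deg u → generous (flip l u) ≡ true →
              C (flip l₂ u) ≡ true → give u (flip l₂ u) ≤ 2 → deficit u ≤ 2
  deficit≤2 u l l₂ l₂≢l 3≤deg gd c₂ give₂ = deficit≤ u 2 (≤-trans decide≤ 3≤deg) (begin
    12 + ∑ (givenTo u)                 ≡⟨ regroup (∑ (givenTo u)) ⟩
    ∑ (givenTo u) + 6 + 4 + 2          ≤⟨ +-monoˡ-≤ 2 (∑-mono-slack₂ (givenTo u) _ l l₂ 6 4 l₂≢l (givenTo≤ u)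
                                             (slack-generous u l gd) (slack-small u l₂ c₂ give₂)) ⟩
    ∑ (λ i → 6 * inC u i) + 2          ≡⟨ cong (_+ 2) (∑6inC u) ⟩
    6 * deg u + 2                      ∎)
    where
    open ≤-Reasoning
    regroup : ∀ x → 12 + x ≡ x + 6 + 4 + 2
    regroup = solve-∀

  deficit≡0 : ∀ u l l₂ l₃ → l₂ ≢ l → l₃ ≢ l → l₃ ≢ l₂ → 3 ≤ deg u → generous (flip l u) ≡ true →
              C (flip l₂ u) ≡ true → give u (flip l₂ u) ≤ 2 → C (flip l₃ u) ≡ true → give u (flip l₃ u) ≤ 2 →
              deficit u ≡ 0
  deficit≡0 u l l₂ l₃ l₂≢l l₃≢l l₃≢l₂ 3≤deg gd c₂ give₂ c₃ give₃ = n≤0⇒n≡0 (deficit≤ u 0 (≤-trans decide≤ 3≤deg) (begin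
    12 + ∑ (givenTo u)                 ≤⟨ +-monoˡ-≤ (∑ (givenTo u)) (decide≤ {12} {14}) ⟩
    14 + ∑ (givenTo u)                 ≡⟨ regroup (∑ (givenTo u)) ⟩
    ∑ (givenTo u) + 6 + (4 + 4)        ≤⟨ ∑-mono-slack₃ (givenTo u) _ l l₂ l₃ 6 4 4 l₂≢l l₃≢l l₃≢l₂ (givenTo≤ u)
                                             (slack-generous u l gd) (slack-small u l₂ c₂ give₂) (slack-small u l₃ c₃ give₃) ⟩
    ∑ (λ i → 6 * inC u i)              ≡⟨ ∑6inC u ⟩
    6 * deg u                          ≡⟨ sym (+-identityʳ _) ⟩
    6 * deg u + 0                      ∎))
    where
    open ≤-Reasoning
    regroup : ∀ x → 14 + x ≡ x + 6 + (4 + 4)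
    regroup = solve-∀

  hub-missing-unique : ∀ {u} (H : Hub u) k → C (flip k u) ≡ false → k ≡ Hub.a H
  hub-missing-unique H k ck with k F.≟ Hub.a H
  ... | yes k≡a = k≡a
  ... | no  k≢a = ⊥-elim (not-¬ (Hub.full H k k≢a) ck)

  -- If l₂ were the missing direction of the hub flip l₁ d, both l₁ and j₁ would be the missing
  -- direction of the hub flip l₂ d; then d = flip j₁ (flip l₁ d) would be starved, hence needy.
  generous-between-hubs : ∀ d l₁ l₂ → generous d ≡ true → (H₁ : Hub (flip l₁ d)) → Hub (flip l₂ d) →
                          l₂ ≢ Hub.a H₁
  generous-between-hubs d l₁ l₂ gd H₁ H₂ l₂≡a₁ = not-¬ (∧≡true⇒ˡ starved-d) (generous⇒¬needy d gd)
    where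
    open Hub H₁ using () renaming (a to a₁; j to j₁)
    u₁ : Word n
    u₁ = flip l₁ d
    flips : flip l₁ (flip a₁ (flip j₁ u₁)) ≡ flip j₁ (flip a₁ d)
    flips = begin
      flip l₁ (flip a₁ (flip j₁ (flip l₁ d)))  ≡⟨ cong (λ z → flip l₁ (flip a₁ z)) (flip-comm j₁ l₁ d) ⟩
      flip l₁ (flip a₁ (flip l₁ (flip j₁ d)))  ≡⟨ cong (flip l₁) (flip-comm a₁ l₁ (flip j₁ d)) ⟩
      flip l₁ (flip l₁ (flip a₁ (flip j₁ d)))  ≡⟨ flip-involutive l₁ _ ⟩
      flip a₁ (flip j₁ d)                      ≡⟨ flip-comm a₁ j₁ d ⟩
      flip j₁ (flip a₁ d)                      ∎
      where open ≡-Reasoning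
    l₁≢a₁ : l₁ ≢ a₁
    l₁≢a₁ l₁≡a₁ = not-¬ (proj₁ (generous⇒ d gd))
      (trans (cong C (sym (flip-involutive l₁ d))) (trans (cong (λ z → C (flip z u₁)) l₁≡a₁) (Hub.a-noncode H₁)))
    j₁≡a₂ : j₁ ≡ Hub.a H₂
    j₁≡a₂ = hub-missing-unique H₂ j₁ (trans (cong (λ z → C (flip j₁ (flip z d))) l₂≡a₁)
                                      (trans (cong C (sym flips)) (Hub.lone-a H₁ l₁ l₁≢a₁)))
    l₁≡a₂ : l₁ ≡ Hub.a H₂
    l₁≡a₂ = hub-missing-unique H₂ l₁ (trans (cong C (trans (flip-comm l₁ l₂ d) (cong (λ z → flip z u₁) l₂≡a₁)))
                                           (Hub.a-noncode H₁))
    starved-d : starved d ≡ true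
    starved-d = trans (cong starved (sym (trans (cong (λ z → flip z u₁) (trans j₁≡a₂ (sym l₁≡a₂)))
                                                (flip-involutive l₁ d))))
                      (Hub.starved-j H₁)

  -- Otherwise both hubs would be the unique neighbour of degree ≥ 3 of this starved codeword.
  common-nbr-unstarved : ∀ d l₁ l₂ → l₂ ≢ l₁ → IsHub (flip l₁ d) → IsHub (flip l₂ d) →
                         starved (flip l₂ (flip l₁ d)) ≡ false
  common-nbr-unstarved d l₁ l₂ l₂≢l₁ hub₁ hub₂ with starved (flip l₂ (flip l₁ d)) in starved-x
  ... | false = refl
  ... | true  = ⊥-elim (l₂≢l₁ (trans (hub-unique x s l₂ big₂) (sym (hub-unique x s l₁ big₁))))
    where
    x : Word n
    x = flip l₂ (flip l₁ d)
    s : StarvedShape x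
    s = starvedShape x starved-x
    big₂ : 3 ≤ deg (flip l₂ x)
    big₂ = subst (λ z → 3 ≤ deg z) (sym (flip-involutive l₂ (flip l₁ d))) (proj₂ (proj₂ hub₁))
    big₁ : 3 ≤ deg (flip l₁ x)
    big₁ = subst (λ z → 3 ≤ deg z) (sym (trans (cong (flip l₁) (flip-comm l₂ l₁ d)) (flip-involutive l₁ (flip l₂ d))))
                 (proj₂ (proj₂ hub₂))

  between-hubs : ∀ d l₁ l₂ → l₂ ≢ l₁ → generous d ≡ true → IsHub (flip l₁ d) → IsHub (flip l₂ d) →
                 C (flip l₂ (flip l₁ d)) ≡ true × give (flip l₁ d) (flip l₂ (flip l₁ d)) ≤ 2
  between-hubs d l₁ l₂ l₂≢l₁ gd hub₁ hub₂ =
    Hub.full H₁ l₂ (generous-between-hubs d l₁ l₂ gd H₁ (hub (flip l₂ d) hub₂)) , (begin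
      giveCase (needy x) (starved x) (atLeast3 (deg u₁)) (share (deg u₁))
                                    ≡⟨ cong (λ b → giveCase (needy x) b (atLeast3 (deg u₁)) (share (deg u₁)))
                                         (common-nbr-unstarved d l₁ l₂ l₂≢l₁ hub₁ hub₂) ⟩
      giveCase (needy x) false (atLeast3 (deg u₁)) (share (deg u₁))
                                    ≤⟨ giveCase-≤ (needy x) false _ _ (λ ()) ⟩
      share (deg u₁)                ≡⟨ cong share (trans (sym (m+n∸n≡m (deg u₁) 1)) (cong (_∸ 1) (Hub.deg≡ H₁))) ⟩
      share (n ∸ 1)                 ≡⟨ share-top ⟩
      2                             ∎)
    where
    open ≤-Reasoning
    u₁ x : Word n
    u₁ = flip l₁ d
    x  = flip l₂ u₁
    H₁ : Hub u₁
    H₁ = hub u₁ hub₁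

  paid : Word n → Fin n → ℕ
  paid d l = guard (not (C (flip l d))) (settle l (flip l d))

  record Settlement (d : Word n) (l : Fin n) : Set where
    field
      generous-d : generous d ≡ true
      deficit>0  : 0 < deficit (flip l d)
      isHub      : IsHub (flip l d)
      paid≤      : paid d l ≤ deficit (flip l d)

  settlement : ∀ d l → 0 < paid d l → Settlement d l
  settlement d l p with guard-positive (not (C (flip l d))) _ p
  ... | noncode , p₂ with guard-positive (isFirst (λ k → generous (flip k (flip l d))) l) _ p₂
  ...   | first , p₃ = record
    { generous-d = generous-d ; deficit>0 = p₃ ; isHub = isHub
    ; paid≤ = ≤-trans (guard-≤ (not (C (flip l d))) _) (guard-≤ (isFirst _ l) (deficit (flip l d))) }
    where
    generous-d : generous d ≡ true
    generous-d = trans (cong generous (sym (flip-involutive l d))) (isFirst⇒ _ l first)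
    isHub : IsHub (flip l d)
    isHub with isHub? (flip l d)
    ... | yes h  = h
    ... | no  ¬h = ⊥-elim (<-irrefl (sym (deficit-nonhub (flip l d) (not-true noncode) ¬h)) p₃)

  generous-back : ∀ d l → generous d ≡ true → generous (flip l (flip l d)) ≡ true
  generous-back d l gd = trans (cong generous (flip-involutive l d)) gd

  hub-deg≥3 : ∀ {d l} → Settlement d l → 3 ≤ deg (flip l d)
  hub-deg≥3 S = proj₂ (proj₂ (Settlement.isHub S))

  paid≤6 : ∀ d l → 0 < paid d l → paid d l ≤ 6
  paid≤6 d l p = ≤-trans (Settlement.paid≤ S)
    (deficit≤6 (flip l d) l (hub-deg≥3 S) (generous-back d l (Settlement.generous-d S)))
    where
    S : Settlement d l
    S = settlement d l p

  paid≤2 : ∀ d l l′ → l ≢ l′ → 0 < paid d l → 0 < paid d l′ → paid d l ≤ 2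
  paid≤2 d l l′ l≢l′ p p′ = ≤-trans (Settlement.paid≤ S)
    (deficit≤2 (flip l d) l l′ (l≢l′ ∘ sym) (hub-deg≥3 S) (generous-back d l (Settlement.generous-d S))
      (proj₁ between) (proj₂ between))
    where
    S : Settlement d l
    S = settlement d l p
    between : C (flip l′ (flip l d)) ≡ true × give (flip l d) (flip l′ (flip l d)) ≤ 2
    between = between-hubs d l l′ (l≢l′ ∘ sym) (Settlement.generous-d S)
                (Settlement.isHub S) (Settlement.isHub (settlement d l′ p′))

  no-three-paid : ∀ d l l₂ l₃ → l₂ ≢ l → l₃ ≢ l → l₃ ≢ l₂ → 0 < paid d l → 0 < paid d l₂ → 0 < paid d l₃ → ⊥
  no-three-paid d l l₂ l₃ l₂≢l l₃≢l l₃≢l₂ p p₂ p₃ = <⇒≢ (Settlement.deficit>0 S)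
    (sym (deficit≡0 (flip l d) l l₂ l₃ l₂≢l l₃≢l l₃≢l₂ (hub-deg≥3 S) (generous-back d l (Settlement.generous-d S))
      (proj₁ (between l₂ l₂≢l p₂)) (proj₂ (between l₂ l₂≢l p₂))
      (proj₁ (between l₃ l₃≢l p₃)) (proj₂ (between l₃ l₃≢l p₃))))
    where
    S : Settlement d l
    S = settlement d l p
    between : ∀ l′ → l′ ≢ l → 0 < paid d l′ →
              C (flip l′ (flip l d)) ≡ true × give (flip l d) (flip l′ (flip l d)) ≤ 2
    between l′ l′≢l p′ = between-hubs d l l′ l′≢l (Settlement.generous-d S)
      (Settlement.isHub S) (Settlement.isHub (settlement d l′ p′))

  ∑paid≤6 : ∀ d → ∑ (paid d) ≤ 6
  ∑paid≤6 d = ∑≤6 (paid d) (paid≤6 d) (paid≤2 d) (no-three-paid d)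

  ∑paid≡0 : ∀ d → generous d ≡ false → ∑ (paid d) ≡ 0
  ∑paid≡0 d ¬gd = ∑-zero (paid d) paid≡0
    where
    paid≡0 : ∀ l → paid d l ≡ 0
    paid≡0 l with paid d l in eq
    ... | zero  = refl
    ... | suc _ = ⊥-elim (not-¬ (Settlement.generous-d (settlement d l (≤-trans (s≤s z≤n) (≤-reflexive (sym eq))))) ¬gd)

  -- Final charges

  paidOn : Word n → ℕ
  paidOn u = ∑ (λ i → guard (C (flip i u)) (settle i u))

  received-noncode : ∀ u → C u ≡ false → received u ≡ 6 * deg u + loneBonus (deg u) + paidOn u
  received-noncode u cu = begin
    ∑ (λ i → transfer i (flip i u))                            ≡⟨ ∑-cong incoming ⟩
    ∑ (λ i → guard (C (flip i u)) (6 + loneBonus (deg u)) + guard (C (flip i u)) (settle i u))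
                                                               ≡⟨ ∑-distrib-+ (λ i → guard (C (flip i u)) (6 + loneBonus (deg u)))
                                                                    (λ i → guard (C (flip i u)) (settle i u)) ⟩
    ∑ (λ i → guard (C (flip i u)) (6 + loneBonus (deg u))) + paidOn u
                                                               ≡⟨ cong (_+ paidOn u) (trans (∑-cong (λ i → guard≡*⟦⟧ (C (flip i u)) (6 + loneBonus (deg u))))
                                                                    (∑-*ˡ (6 + loneBonus (deg u)) (inC u))) ⟩
    (6 + loneBonus (deg u)) * deg u + paidOn u                 ≡⟨ cong (_+ paidOn u)
                                                                    (trans (*-distribʳ-+ (deg u) 6 (loneBonus (deg u)))
                                                                           (cong (6 * deg u +_) (loneBonus-* (deg u)))) ⟩
    6 * deg u + loneBonus (deg u) + paidOn u                   ∎
    where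
    open ≡-Reasoning
    incoming : ∀ i → transfer i (flip i u) ≡
                     guard (C (flip i u)) (6 + loneBonus (deg u)) + guard (C (flip i u)) (settle i u)
    incoming i = begin
      transfer i (flip i u)                                                 ≡⟨ cong (λ z → transferCase (C (flip i u)) (C z)
                                                                                 (6 + loneBonus (deg z) + settle i z) (give (flip i u) z))
                                                                                 (flip-involutive i u) ⟩
      transferCase (C (flip i u)) (C u) (6 + loneBonus (deg u) + settle i u) (give (flip i u) u)
                                                                            ≡⟨ cong (λ b → transferCase (C (flip i u)) b (6 + loneBonus (deg u) + settle i u)
                                                                                 (give (flip i u) u)) cu ⟩
      transferCase (C (flip i u)) false (6 + loneBonus (deg u) + settle i u) (give (flip i u) u)
                                                                            ≡⟨ transferCase-to-noncode (C (flip i u)) _ _ ⟩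
      guard (C (flip i u)) (6 + loneBonus (deg u) + settle i u)            ≡⟨ guard-distrib-+ (C (flip i u)) _ _ ⟩
      guard (C (flip i u)) (6 + loneBonus (deg u)) + guard (C (flip i u)) (settle i u) ∎

  sent-noncode : ∀ u → C u ≡ false → sent u ≡ given u
  sent-noncode u cu = ∑-cong λ i →
    trans (cong (λ b → transferCase b (C (flip i u)) (6 + loneBonus (deg (flip i u)) + settle i (flip i u))
                                        (give u (flip i u))) cu)
          (transferCase-from-noncode (C (flip i u)) _ _)

  -- The first generous neighbour of u pays the whole deficit of u.
  budget-generous-nbr : ∀ u k → generous (flip k u) ≡ true →
                        12 + given u ≤ 6 * deg u + loneBonus (deg u) + paidOn u
  budget-generous-nbr u k gk with ∃isFirst (λ k → generous (flip k u)) k gk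
  ... | k₀ , first = begin
    12 + given u                                        ≤⟨ m≤n+m∸n (12 + given u) (6 * deg u + loneBonus (deg u)) ⟩
    6 * deg u + loneBonus (deg u) + deficit u           ≡⟨ cong (6 * deg u + loneBonus (deg u) +_) (sym settled) ⟩
    6 * deg u + loneBonus (deg u) + guard (C (flip k₀ u)) (settle k₀ u)
                                                        ≤⟨ +-monoʳ-≤ _ (≤∑ (λ i → guard (C (flip i u)) (settle i u)) k₀) ⟩
    6 * deg u + loneBonus (deg u) + paidOn u            ∎
    where
    open ≤-Reasoning
    settled : guard (C (flip k₀ u)) (settle k₀ u) ≡ deficit u
    settled = cong₂ (λ b b′ → guard b (guard b′ (deficit u)))
                (proj₁ (generous⇒ (flip k₀ u) (isFirst⇒ (λ k → generous (flip k u)) k₀ first))) first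

  budget-no-generous-nbr : ∀ u → C u ≡ false → (∀ k → generous (flip k u) ≢ true) →
                           12 + given u ≤ 6 * deg u + loneBonus (deg u) + paidOn u
  budget-no-generous-nbr u cu none = begin
    12 + given u                                        ≤⟨ +-monoʳ-≤ 12 (given-nonhub u ¬hub) ⟩
    12 + deg u * share (deg u)                          ≤⟨ share-budget (deg u) (dominated u cu) ⟩
    6 * deg u + loneBonus (deg u)                       ≤⟨ m≤m+n _ (paidOn u) ⟩
    6 * deg u + loneBonus (deg u) + paidOn u            ∎
    where
    open ≤-Reasoning
    ¬hub : ¬ IsHub u
    ¬hub h = let k , gk = hub-generous-nbr u cu (hub u h) in none k gk

  noncode-budget : ∀ u → C u ≡ false → 12 + given u ≤ 6 * deg u + loneBonus (deg u) + paidOn u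
  noncode-budget u cu with any? (λ k → generous (flip k u) B.≟ true)
  ... | yes (k , gk) = budget-generous-nbr u k gk
  ... | no  none     = budget-no-generous-nbr u cu (λ k gk → none (k , gk))

  local-noncode : ∀ u → C u ≡ false → 12 + sent u ≤ charge u + received u
  local-noncode u cu = begin
    12 + sent u                                         ≡⟨ cong (12 +_) (sent-noncode u cu) ⟩
    12 + given u                                        ≤⟨ noncode-budget u cu ⟩
    6 * deg u + loneBonus (deg u) + paidOn u            ≡⟨ sym (received-noncode u cu) ⟩
    received u                                          ≡⟨ cong (λ b → guard b (6 * n + 12) + received u) (sym cu) ⟩
    charge u + received u                               ∎
    where open ≤-Reasoning

  gifts : Word n → ℕ
  gifts c = ∑ (λ i → guard (not (C (flip i c))) (give (flip i c) c))

  outgoing-code : ∀ c i → C c ≡ true →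
                  transfer i c ≡ guard (not (C (flip i c))) 6 + 6 * lone (flip i c) + paid c i
  outgoing-code c i cc = begin
    transfer i c                                              ≡⟨ cong (λ b → transferCase b (C (flip i c)) X (give c (flip i c))) cc ⟩
    transferCase true (C (flip i c)) X (give c (flip i c))    ≡⟨ transferCase-from-code (C (flip i c)) X _ ⟩
    guard (not (C (flip i c))) X                              ≡⟨ guard-distrib-+ (not (C (flip i c))) _ _ ⟩
    guard (not (C (flip i c))) (6 + loneBonus (deg (flip i c))) + paid c i
                                                              ≡⟨ cong (_+ paid c i) (guard-distrib-+ (not (C (flip i c))) 6 _) ⟩
    guard (not (C (flip i c))) 6 + guard (not (C (flip i c))) (loneBonus (deg (flip i c))) + paid c i
                                                              ≡⟨ cong (λ z → guard (not (C (flip i c))) 6 + z + paid c i)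
                                                                   (guard-loneBonus (C (flip i c)) (deg (flip i c))) ⟩
    guard (not (C (flip i c))) 6 + 6 * lone (flip i c) + paid c i ∎
    where
    open ≡-Reasoning
    X : ℕ
    X = 6 + loneBonus (deg (flip i c)) + settle i (flip i c)

  sent-code : ∀ c → C c ≡ true → sent c + 6 * deg c ≡ 6 * n + (6 * loneNbrs c + ∑ (paid c))
  sent-code c cc = begin
    sent c + 6 * deg c                                                   ≡⟨ cong (_+ 6 * deg c) (trans (∑-cong (λ i → outgoing-code c i cc))
                                                                              (trans (∑-distrib-+ _ (paid c))
                                                                                (cong (_+ ∑ (paid c)) (∑-distrib-+ B _)))) ⟩
    ∑ B + ∑ (λ i → 6 * lone (flip i c)) + ∑ (paid c) + 6 * deg c        ≡⟨ cong (λ z → ∑ B + z + ∑ (paid c) + 6 * deg c)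
                                                                              (∑-*ˡ 6 (λ i → lone (flip i c))) ⟩
    ∑ B + 6 * loneNbrs c + ∑ (paid c) + 6 * deg c                         ≡⟨ regroup (∑ B) (6 * loneNbrs c) (∑ (paid c)) (6 * deg c) ⟩
    (∑ B + 6 * deg c) + (6 * loneNbrs c + ∑ (paid c))                     ≡⟨ cong (_+ (6 * loneNbrs c + ∑ (paid c))) six-each ⟩
    6 * n + (6 * loneNbrs c + ∑ (paid c))                                 ∎
    where
    open ≡-Reasoning
    B : Fin n → ℕ
    B i = guard (not (C (flip i c))) 6
    regroup : ∀ b p x k → b + p + x + k ≡ (b + k) + (p + x)
    regroup = solve-∀
    guard-6 : ∀ b → guard (not b) 6 + 6 * ⟦ b ⟧ ≡ 6
    guard-6 true  = refl
    guard-6 false = refl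
    six-each : ∑ B + 6 * deg c ≡ 6 * n
    six-each = begin
      ∑ B + 6 * deg c                   ≡⟨ cong (∑ B +_) (sym (∑-*ˡ 6 (inC c))) ⟩
      ∑ B + ∑ (λ i → 6 * inC c i)       ≡⟨ sym (∑-distrib-+ B _) ⟩
      ∑ (λ i → B i + 6 * inC c i)       ≡⟨ ∑-cong (λ i → guard-6 (C (flip i c))) ⟩
      ∑ {n} (λ _ → 6)                   ≡⟨ trans (∑-const {n} 6) (*-comm n 6) ⟩
      6 * n                             ∎

  received-code : ∀ c → C c ≡ true → received c ≡ gifts c
  received-code c cc = ∑-cong λ i → begin
    transfer i (flip i c)                                           ≡⟨ cong (λ z → transferCase (C (flip i c)) (C z)
                                                                         (6 + loneBonus (deg z) + settle i z) (give (flip i c) z))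
                                                                         (flip-involutive i c) ⟩
    transferCase (C (flip i c)) (C c) _ (give (flip i c) c)         ≡⟨ cong (λ b → transferCase (C (flip i c)) b
                                                                         (6 + loneBonus (deg c) + settle i c) (give (flip i c) c)) cc ⟩
    transferCase (C (flip i c)) true _ (give (flip i c) c)          ≡⟨ transferCase-to-code (C (flip i c)) _ _ ⟩
    guard (not (C (flip i c))) (give (flip i c) c)                  ∎
    where open ≡-Reasoning

  gifts-starved : ∀ c → starved c ≡ true → 6 ≤ gifts c
  gifts-starved c starved-c = ≤-trans (≤-reflexive (sym from-hub)) (≤∑ (λ i → guard (not (C (flip i c))) (give (flip i c) c)) j)
    where
    s : StarvedShape c
    s = starvedShape c starved-c
    j : Fin n
    j = StarvedShape.j s
    from-hub : guard (not (C (flip j c))) (give (flip j c) c) ≡ 6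
    from-hub = begin
      guard (not (C (flip j c))) (give (flip j c) c)            ≡⟨ cong (λ b → guard (not b) (give (flip j c) c))
                                                                     (StarvedShape.isolated s j) ⟩
      giveCase (needy c) (starved c) (atLeast3 (deg (flip j c))) (share (deg (flip j c)))
                                                                ≡⟨ cong₃ {needy c} {true} {starved c} {true} {w = share (deg (flip j c))} (∧≡true⇒ˡ starved-c) starved-c
                                                                     (atLeast3-intro _ (hub≥3 (StarvedShape.deg-j s))) ⟩
      giveCase true true true (share (deg (flip j c)))          ≡⟨⟩
      6                                                         ∎
      where
      open ≡-Reasoning
      cong₃ : ∀ {x x′ y y′ z z′} {w} → x ≡ x′ → y ≡ y′ → z ≡ z′ → giveCase x y z w ≡ giveCase x′ y′ z′ w
      cong₃ refl refl refl = refl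
      hub≥3 : ∀ {t} → t + 1 ≡ n → 3 ≤ t
      hub≥3 {t} t+1≡n = +-cancelʳ-≤ 1 3 t (≤-trans (≤-trans decide≤ 10≤n) (≤-reflexive (sym t+1≡n)))
  gifts-unstarved : ∀ c → needy c ≡ true → starved c ≡ false → 6 ≤ gifts c
  gifts-unstarved c needy-c starved-c = begin
    6                 ≤⟨ below6-false (offered c) (trans (cong (λ b → b ∧ below6 (offered c)) (sym needy-c)) starved-c) ⟩
    offered c         ≡⟨ ∑-cong offer≡gift ⟩
    gifts c           ∎
    where
    open ≤-Reasoning
    offer≡gift : ∀ i → offer (flip i c) ≡ guard (not (C (flip i c))) (give (flip i c) c)
    offer≡gift i = cong (guard (not (C (flip i c))))
      (sym (cong₂ (λ b b′ → giveCase b b′ (atLeast3 (deg (flip i c))) (share (deg (flip i c)))) needy-c starved-c))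

  gifts-needy : ∀ c → needy c ≡ true → 6 ≤ gifts c
  gifts-needy c needy-c = by-cases (starved c) refl
    where
    by-cases : ∀ b → starved c ≡ b → 6 ≤ gifts c
    by-cases true  = gifts-starved c
    by-cases false = gifts-unstarved c needy-c

  lone-budget : ∀ c → C c ≡ true → 6 * loneNbrs c ≤ 6 * deg c + gifts c
  lone-budget c cc = by-cases (loneNbrs c) refl (deg c) refl
    where
    open ≤-Reasoning
    by-cases : ∀ p → loneNbrs c ≡ p → ∀ t → deg c ≡ t → 6 * loneNbrs c ≤ 6 * deg c + gifts c
    by-cases zero          p≡ _       _  = ≤-trans (≤-reflexive (cong (6 *_) p≡)) z≤n
    by-cases (suc (suc _)) p≡ _       _  = ⊥-elim (1+n≰n (≤-trans (s≤s (s≤s z≤n))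
                                             (≤-trans (≤-reflexive (sym p≡)) (loneNbrs≤1 c cc))))
    by-cases (suc zero)    p≡ (suc t) t≡ = begin
      6 * loneNbrs c           ≡⟨ cong (6 *_) p≡ ⟩
      6 * 1                    ≤⟨ *-monoʳ-≤ 6 (s≤s (z≤n {t})) ⟩
      6 * suc t                ≡⟨ cong (6 *_) (sym t≡) ⟩
      6 * deg c                ≤⟨ m≤m+n _ _ ⟩
      6 * deg c + gifts c      ∎
    by-cases (suc zero)    p≡ zero    t≡ = begin
      6 * loneNbrs c           ≡⟨ cong (6 *_) p≡ ⟩
      6                        ≤⟨ gifts-needy c (trans (cong₂ (isNeedy (C c)) t≡ p≡) (cong (λ b → isNeedy b 0 1) cc)) ⟩
      gifts c                  ≤⟨ m≤n+m _ _ ⟩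
      6 * deg c + gifts c      ∎

  code-budget : ∀ c → C c ≡ true → 6 * loneNbrs c + ∑ (paid c) ≤ 6 * deg c + gifts c
  code-budget c cc = by-cases (generous c) refl
    where
    open ≤-Reasoning
    by-cases : ∀ b → generous c ≡ b → 6 * loneNbrs c + ∑ (paid c) ≤ 6 * deg c + gifts c
    by-cases true  gd = begin
      6 * loneNbrs c + ∑ (paid c)      ≡⟨ cong (λ z → 6 * z + ∑ (paid c)) (proj₂ (proj₂ (generous⇒ c gd))) ⟩
      ∑ (paid c)                       ≤⟨ ∑paid≤6 c ⟩
      6                                ≤⟨ *-monoʳ-≤ 6 (proj₁ (proj₂ (generous⇒ c gd))) ⟩
      6 * deg c                        ≤⟨ m≤m+n _ _ ⟩
      6 * deg c + gifts c              ∎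
    by-cases false ¬gd = begin
      6 * loneNbrs c + ∑ (paid c)      ≡⟨ trans (cong (6 * loneNbrs c +_) (∑paid≡0 c ¬gd)) (+-identityʳ _) ⟩
      6 * loneNbrs c                   ≤⟨ lone-budget c cc ⟩
      6 * deg c + gifts c              ∎

  local-code : ∀ c → C c ≡ true → 12 + sent c ≤ charge c + received c
  local-code c cc = +-cancelʳ-≤ (6 * deg c) _ _ (begin
    12 + sent c + 6 * deg c                     ≡⟨ trans (+-assoc 12 (sent c) _) (cong (12 +_) (sent-code c cc)) ⟩
    12 + (6 * n + (6 * loneNbrs c + ∑ (paid c))) ≤⟨ +-monoʳ-≤ 12 (+-monoʳ-≤ (6 * n) (code-budget c cc)) ⟩
    12 + (6 * n + (6 * deg c + gifts c))        ≡⟨ regroup 12 (6 * n) (6 * deg c) (gifts c) ⟩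
    6 * n + 12 + gifts c + 6 * deg c            ≡⟨ cong₂ (λ b r → guard b (6 * n + 12) + r + 6 * deg c)
                                                     (sym cc) (sym (received-code c cc)) ⟩
    charge c + received c + 6 * deg c           ∎)
    where
    open ≤-Reasoning
    regroup : ∀ a b d g → a + (b + (d + g)) ≡ b + a + g + d
    regroup = solve-∀

  local : ∀ u → 12 + sent u ≤ charge u + received u
  local u = by-cases (C u) refl
    where
    by-cases : ∀ b → C u ≡ b → 12 + sent u ≤ charge u + received u
    by-cases true  = local-code u
    by-cases false = local-noncode u

corollary6 : ∀ (n : ℕ) → 10 ≤ n → (C : Code n) → IsLocatingDominating C →
    2 ^ (n + 1) ≤ (n + 2) * size C
corollary6 n 10≤n C ld = *-cancelˡ-≤ 6 (begin
  6 * 2 ^ (n + 1)             ≡⟨ cong (6 *_) (^-distribˡ-+-* 2 n 1) ⟩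
  6 * (2 ^ n * 2 ^ 1)         ≡⟨ double (2 ^ n) ⟩
  12 * 2 ^ n                  ≤⟨ discharging 12 charge transfer (Analysis.local C ld 10≤n) ⟩
  ∑ᵂ n charge                 ≡⟨ ∑ᵂ-guard C (6 * n + 12) ⟩
  (6 * n + 12) * size C       ≡⟨ factor n (size C) ⟩
  6 * ((n + 2) * size C)      ∎)
  where
  open Scheme C
  open ≤-Reasoning
  double : ∀ x → 6 * (x * 2 ^ 1) ≡ 12 * x
  double = solve-∀
  factor : ∀ m s → (6 * m + 12) * s ≡ 6 * ((m + 2) * s)
  factor = solve-∀
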